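{- Let $W$ be a universe and $v$ an assignment in $W$. (1) For every term $t$ of $\mathcal{L}_{RST}^{\{HF\}}$, $\|t\|^W_v\in W$. (2a) If $\varphi$ is a formula of $\mathcal{L}_{RST}^{\{HF\}}$ with $\varphi\succ\{y_1,\dots,y_n\}$ and $n>0$, then $\{\langle a_1,\dots,a_n\rangle\in W^n : \|\varphi\|^W_{v[y_1:=a_1,\dots,y_n:=a_n]}=\mathbf{t}\}\in W$. (2b) If $\varphi\succ\emptyset$ and $\{y_1,\dots,y_n\}\subseteq Fv(\varphi)$, then for every $X\in W$, $\{\langle a_1,\dots,a_n\rangle\in X^n : \|\varphi\|^W_{v[y_1:=a_1,\dots,y_n:=a_n]}=\mathbf{t}\}\in W$.
   Context: The language $\mathcal{L}_{RST}^{\{HF\}}$ is first-order with binary relations $\in,=$, one constant $HF$, connectives $\neg,\wedge,\vee$, the quantifier $\exists$, and set-abstraction terms. Terms, formulas and the safety relation $\varphi\succ\Theta$ (a relation between a formula and a finite set of variables) are defined simultaneously: terms are the variables, $HF$, and $\{x\mid\varphi\}$ whenever $\varphi\succ\{x\}$ ($x$ becomes bound; $Fv(\{x\mid\varphi\})=Fv(\varphi)\setminus\{x\}$); atomic formulas are $t=s$ and $t\in s$ for terms $t,s$; formulas are closed under $\neg,\wedge,\vee,\exists x$. Safety rules: every atomic formula is $\succ\emptyset$; if $x\notin Fv(t)$, each of $x\neq x$, $x\in t$, $x=t$, $t=x$ is $\succ\{x\}$; if $\varphi\succ\emptyset$ then $\neg\varphi\succ\emptyset$; if $\varphi\succ\Theta$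 and $\psi\succ\Theta$ then $\varphi\vee\psi\succ\Theta$; if $\varphi\succ\Theta$, $\psi\succ\Phi$ and ($\Phi\cap Fv(\varphi)=\emptyset$ or $\Theta\cap Fv(\psi)=\emptyset$) then $\varphi\wedge\psi\succ\Theta\cup\Phi$; if $\varphi\succ\Theta$ and $y\in\Theta$ then $\exists y\varphi\succ\Theta\setminus\{y\}$. Pairs are $\langle s,t\rangle=\{\{s\},\{s,t\}\}$ and $\langle a_1,\dots,a_n\rangle=\langle\langle a_1,\dots,a_{n-1}\rangle,a_n\rangle$. $\mathcal{HF}$ is the set of hereditarily finite sets. The HF-rudimentary functions are the functions obtained by composition from $F_0(x,y)=\{x,y\}$, $F_1(x,y)=x\setminus y$, $F_2(x,y)=x\times y$, $F_3(x,y)=\{\langle u,z,v\rangle: z\in x,\ \langle u,v\rangle\in y\}$, $F_4(x,y)=\{\langle z,v,u\rangle: z\in x,\ \langle u,v\rangle\in y\}$, $F_5(x,y)=\{\{w:\exists u\in z\,\langle u,w\rangle\in x\}: z\in y\}$, $F_6(x)=\bigcup x$, $F_7(x)=\{v:\exists w\,\langle v,w\rangle\in x\}$, $F_8(x)=\{\langle u,v\rangle: u\in x, v\in x, u\in v\}$, and the constant function $F_9(x)=\mathcal{HF}$. A universe is a transitive collection of sets closed under all HF-rudimentary functions, viewed as a structure interpreting $\in,=$ standardly and $HF$ as $\mathcal{HF}$. For an assignment $v$ in $W$, values are defined recursively: $\|x\|^W_v=v(x)$; $\|HF\|^W_v=\mathcal{HF}$; $\|\{x\mid\varphi\}\|^W_v=\{a\in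 W:\|\varphi\|^W_{v[x:=a]}=\mathbf{t}\}$; $\|t=s\|^W_v=\mathbf{t}$ iff $\|t\|^W_v=\|s\|^W_v$; $\|t\in s\|^W_v=\mathbf{t}$ iff $\|t\|^W_v\in\|s\|^W_v$; $\neg,\wedge,\vee$ are classical; $\|\exists x\varphi\|^W_v=\mathbf{t}$ iff $\|\varphi\|^W_{v[x:=a]}=\mathbf{t}$ for some $a\in W$. Here $v[x:=a]$ is the $x$-variant of $v$ assigning $a$ to $x$. -}

module Defs where

open import Level using (Level; Lift; lift) renaming (suc to lsuc; zero to lzero)
open import Data.Nat using (ℕ; zero; suc; _≡ᵇ_)
open import Data.Bool using (Bool; true; false; if_then_else_)
open import Data.List using (List; []; _∷_; _++_)
open import Data.List.Membership.Propositional using () renaming (_∈_ to _∈ℓ_)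
open import Data.List.Relation.Unary.All using (All)
open import Data.List.Relation.Unary.Any using (Any)
open import Data.Vec using (Vec; []; _∷_; toList)
open import Data.Product using (Σ; _×_; _,_)
open import Data.Sum using (_⊎_)
open import Data.Empty using (⊥)
open import Relation.Nullary using (¬_)
open import Function.Bundles using (_⇔_)

-- Ambient set theory: Aczel's model of sets (well-founded trees),
-- equality = extensional bisimulation, membership up to equality.

data V : Set₁ where
  sup : (A : Set) → (A → V) → V

_≅_ : V → V → Set
sup A f ≅ sup B g =
  ((a : A) → Σ B λ b → f a ≅ g b) × ((b : B) → Σ A λ a → f a ≅ g b)

_∈ᵥ_ : V → V → Set
x ∈ᵥ sup A f = Σ A λ a → x ≅ f a

⌞_⌟ : Set → Set₁
⌞ P ⌟ = Lift (lsuc lzero) P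

Cls : Set₂
Cls = V → Set₁

-- "the collection C is (the extension of) a set belonging to W"
_∈W_ : Cls → (V → Set₁) → Set₁
C ∈W W = Σ V λ w → W w × ((z : V) → ⌞ z ∈ᵥ w ⌟ ⇔ C z)

upair : V → V → V
upair x y = sup Bool (λ b → if b then x else y)

⟨_,_⟩ : V → V → V
⟨ s , t ⟩ = upair (upair s s) (upair s t)

-- ⟨a1,...,an⟩ = ⟨⟨a1,...,a(n-1)⟩,an⟩ ,  ⟨a1⟩ = a1
tupleGo : ∀ {n} → V → Vec V n → V
tupleGo acc [] = acc
tupleGo acc (b ∷ bs) = tupleGo ⟨ acc , b ⟩ bs

tuple : ∀ {n} → Vec V (suc n) → V
tuple (a ∷ as) = tupleGo a as

data IsHF : V → Set₁ where
  hf : (x : V) (xs : List V) → All IsHF xs →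
       ((z : V) → ⌞ z ∈ᵥ x ⌟ ⇔ Any (λ y → ⌞ z ≅ y ⌟) xs) → IsHF x

F0 F1 F2 F3 F4 F5 F8 : V → V → Cls
F0 x y z = ⌞ z ≅ x ⌟ ⊎ ⌞ z ≅ y ⌟
F1 x y z = ⌞ z ∈ᵥ x ⌟ × ¬ ⌞ z ∈ᵥ y ⌟
F2 x y z = Σ V λ u → Σ V λ w → ⌞ u ∈ᵥ x ⌟ × ⌞ w ∈ᵥ y ⌟ × ⌞ z ≅ ⟨ u , w ⟩ ⌟
F3 x y c = Σ V λ u → Σ V λ z → Σ V λ w →
  ⌞ z ∈ᵥ x ⌟ × ⌞ ⟨ u , w ⟩ ∈ᵥ y ⌟ × ⌞ c ≅ ⟨ ⟨ u , z ⟩ , w ⟩ ⌟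
F4 x y c = Σ V λ u → Σ V λ z → Σ V λ w →
  ⌞ z ∈ᵥ x ⌟ × ⌞ ⟨ u , w ⟩ ∈ᵥ y ⌟ × ⌞ c ≅ ⟨ ⟨ z , w ⟩ , u ⟩ ⌟
F5 x y c = Σ V λ z → ⌞ z ∈ᵥ y ⌟ ×
  ((w : V) → ⌞ w ∈ᵥ c ⌟ ⇔ (Σ V λ u → ⌞ u ∈ᵥ z ⌟ × ⌞ ⟨ u , w ⟩ ∈ᵥ x ⌟))
F8 x y c = Σ V λ u → Σ V λ w →
  ⌞ u ∈ᵥ x ⌟ × ⌞ w ∈ᵥ x ⌟ × ⌞ u ∈ᵥ w ⌟ × ⌞ c ≅ ⟨ u , w ⟩ ⌟

F6 F7 : V → Cls
F6 x z = Σ V λ y → ⌞ y ∈ᵥ x ⌟ × ⌞ z ∈ᵥ y ⌟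
F7 x z = Σ V λ w → ⌞ ⟨ z , w ⟩ ∈ᵥ x ⌟

record IsUniverse (W : V → Set₁) : Set₂ where
  field
    resp  : ∀ {x y} → x ≅ y → W x → W y
    trans : ∀ {x y} → W x → y ∈ᵥ x → W y
    cl0 : ∀ {x y} → W x → W y → F0 x y ∈W W
    cl1 : ∀ {x y} → W x → W y → F1 x y ∈W W
    cl2 : ∀ {x y} → W x → W y → F2 x y ∈W W
    cl3 : ∀ {x y} → W x → W y → F3 x y ∈W W
    cl4 : ∀ {x y} → W x → W y → F4 x y ∈W W
    cl5 : ∀ {x y} → W x → W y → F5 x y ∈W W
    cl6 : ∀ {x} → W x → F6 x ∈W W
    cl7 : ∀ {x} → W x → F7 x ∈W W
    cl8 : ∀ {x} → W x → F8 x x ∈W W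
    cl9 : ∀ {x} → W x → IsHF ∈W W

Var : Set
Var = ℕ

rm : Var → List Var → List Var
rm y [] = []
rm y (z ∷ zs) = if z ≡ᵇ y then rm y zs else z ∷ rm y zs

Disjoint : List Var → List Var → Set
Disjoint A B = (z : Var) → z ∈ℓ A → z ∈ℓ B → ⊥

data Term : Set
data Formula : Set
data _≻_ : Formula → List Var → Set
FvT : Term → List Var
FvF : Formula → List Var

data Term where
  var : Var → Term
  HF  : Term
  abs : (x : Var) (φ : Formula) → φ ≻ (x ∷ []) → Term

data Formula where
  _≐_  : Term → Term → Formula
  _∈'_ : Term → Term → Formula
  ¬'_  : Formula → Formula
  _∧'_ : Formula → Formula → Formula
  _∨'_ : Formula → Formula → Formula
  ∃'   : Var → Formula → Formula

-- finite sets of variables are represented by lists; s-set makes the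
-- relation depend only on the underlying set.
data _≻_ where
  s-atEq : ∀ t s → (t ≐ s) ≻ []
  s-atIn : ∀ t s → (t ∈' s) ≻ []
  s-neq  : ∀ x → (¬' (var x ≐ var x)) ≻ (x ∷ [])
  s-in   : ∀ x t → ¬ (x ∈ℓ FvT t) → (var x ∈' t) ≻ (x ∷ [])
  s-eqL  : ∀ x t → ¬ (x ∈ℓ FvT t) → (var x ≐ t) ≻ (x ∷ [])
  s-eqR  : ∀ x t → ¬ (x ∈ℓ FvT t) → (t ≐ var x) ≻ (x ∷ [])
  s-neg  : ∀ {φ} → φ ≻ [] → (¬' φ) ≻ []
  s-or   : ∀ {φ ψ Θ} → φ ≻ Θ → ψ ≻ Θ → (φ ∨' ψ) ≻ Θ
  s-and  : ∀ {φ ψ Θ Φ} → φ ≻ Θ → ψ ≻ Φ →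
           Disjoint Φ (FvF φ) ⊎ Disjoint Θ (FvF ψ) → (φ ∧' ψ) ≻ (Θ ++ Φ)
  s-ex   : ∀ {φ Θ y} → φ ≻ Θ → y ∈ℓ Θ → (∃' y φ) ≻ rm y Θ
  s-set  : ∀ {φ Θ Θ'} → φ ≻ Θ → ((z : Var) → z ∈ℓ Θ ⇔ z ∈ℓ Θ') → φ ≻ Θ'

FvT (var x) = x ∷ []
FvT HF = []
FvT (abs x φ _) = rm x (FvF φ)

FvF (t ≐ s) = FvT t ++ FvT s
FvF (t ∈' s) = FvT t ++ FvT s
FvF (¬' φ) = FvF φ
FvF (φ ∧' ψ) = FvF φ ++ FvF ψ
FvF (φ ∨' ψ) = FvF φ ++ FvF ψ
FvF (∃' x φ) = rm x (FvF φ)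

Assignment : Set₁
Assignment = Var → V

_[_≔_] : Assignment → Var → V → Assignment
(v [ x ≔ a ]) z = if z ≡ᵇ x then a else v z

_[_≔*_] : ∀ {n} → Assignment → Vec Var n → Vec V n → Assignment
v [ [] ≔* [] ] = v
v [ y ∷ ys ≔* a ∷ as ] = (v [ y ≔ a ]) [ ys ≔* as ]

module Semantics (W : V → Set₁) where

  ‖_‖t : Term → Assignment → Cls
  ‖_‖f : Formula → Assignment → Set₁

  ‖ var x ‖t v z = ⌞ z ∈ᵥ v x ⌟
  ‖ HF ‖t v z = IsHF z
  ‖ abs x φ _ ‖t v a = W a × ‖ φ ‖f (v [ x ≔ a ])

  ‖ t ≐ s ‖f v = (z : V) → ‖ t ‖t v z ⇔ ‖ s ‖t v z
  ‖ t ∈' s ‖f v = Σ V λ a → ((z : V) → ⌞ z ∈ᵥ a ⌟ ⇔ ‖ t ‖t v z) × ‖ s ‖t v a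
  ‖ ¬' φ ‖f v = ¬ ‖ φ ‖f v
  ‖ φ ∧' ψ ‖f v = ‖ φ ‖f v × ‖ ψ ‖f v
  ‖ φ ∨' ψ ‖f v = ‖ φ ‖f v ⊎ ‖ ψ ‖f v
  ‖ ∃' x φ ‖f v = Σ V λ a → W a × ‖ φ ‖f (v [ x ≔ a ])

-- Simultaneous induction on terms and safe formulas, the variables outside a
-- parameter list ys being fixed by v and the parameters ranging over an arbitrary
-- X ∈ W.  For φ ≻ Θ, the tuples of parameters satisfying φ form a set in W
-- (Boolean operations by ∖ and ∪, ∃ by the domain map F7, atomic formulas through
-- graphs of variables built with F3, F4 and the diagonal), and the values that
-- satisfying assignments give to the safe variables Θ lie in one member of W,
-- which turns every quantifier into a bounded one.  For a term, membership in it
-- is separable in the same sense, and its elements and its values lie in fixed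
-- members of W; the values of {x | φ} are the sections of the set defined by φ,
-- collected by F5.  Parts (1) and (2a) first bound the relevant variables; (2b)
-- is the separation step itself.  Excluded middle enters through intersections
-- and through the extensional equality t = s.

module Submission where

open import Defs
open import Level using (lift; lower) renaming (suc to lsuc; zero to lzero)
open import Axiom.ExcludedMiddle using (ExcludedMiddle)
open import Data.Bool using (true; false)
open import Data.Empty using (⊥-elim)
open import Data.List using (List; []; _∷_; _++_)
open import Data.List.Membership.Propositional using () renaming (_∈_ to _∈ℓ_)
open import Data.List.Membership.Propositional.Properties using (∈-++⁺ˡ; ∈-++⁺ʳ; ∈-++⁻)
open import Data.List.Relation.Unary.Any using (here; there)
open import Data.Nat using (ℕ; zero; suc; _≡ᵇ_; _≤_)
open import Data.Nat.ListAction using (sum)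
open import Data.Nat.Properties using (_≟_; <-irrefl; m≤m+n; m≤n+m; ≤-trans)
open import Data.List.Membership.DecPropositional _≟_ using (_∈?_)
open import Data.Product using (Σ; _×_; _,_; proj₁; proj₂)
open import Data.Sum using (_⊎_; inj₁; inj₂; [_,_]′; swap)
open import Data.Vec using (Vec; []; _∷_; _∷ʳ_; initLast; toList; fromList; map) renaming (_++_ to _++ᵛ_)
open import Data.Vec.Properties using (toList∘fromList)
open import Data.Vec.Relation.Unary.All using (All; []; _∷_)
import Data.Vec.Relation.Unary.All as All
open import Data.Vec.Relation.Unary.All.Properties using (++⁺)
open import Data.Vec.Relation.Unary.Unique.Propositional using (Unique; []; _∷_)
open import Data.Vec.Relation.Binary.Pointwise.Inductive using (Pointwise; []; _∷_)
open import Function.Bundles using (_⇔_; mk⇔; Equivalence)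
open import Relation.Binary.Bundles using (Setoid)
open import Relation.Binary.PropositionalEquality using (_≡_; _≢_; refl; sym; trans; cong; subst)
open import Relation.Nullary using (¬_; yes; no)
import Relation.Binary.Reasoning.Setoid as SetoidReasoning

open Equivalence using (to; from)

-- Sets as well-founded trees

≅-refl : ∀ x → x ≅ x
≅-refl (sup A f) = (λ a → a , ≅-refl (f a)) , (λ b → b , ≅-refl (f b))

≅-sym : ∀ {x y} → x ≅ y → y ≅ x
≅-sym {sup A f} {sup B g} (p , q) =
  (λ b → proj₁ (q b) , ≅-sym (proj₂ (q b))) , (λ a → proj₁ (p a) , ≅-sym (proj₂ (p a)))

≅-trans : ∀ {x y z} → x ≅ y → y ≅ z → x ≅ z
≅-trans {sup A f} {sup B g} {sup C h} (p , q) (r , s) =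
  (λ a → proj₁ (r (proj₁ (p a))) , ≅-trans (proj₂ (p a)) (proj₂ (r (proj₁ (p a))))) ,
  (λ c → proj₁ (q (proj₁ (s c))) , ≅-trans (proj₂ (q (proj₁ (s c)))) (proj₂ (s c)))

≅-setoid : Setoid (lsuc lzero) lzero
≅-setoid = record
  { Carrier = V
  ; _≈_ = _≅_
  ; isEquivalence = record { refl = ≅-refl _ ; sym = ≅-sym ; trans = ≅-trans }
  }

≡⇒≅ : ∀ {x y} → x ≡ y → x ≅ y
≡⇒≅ {x} refl = ≅-refl x

∈-respˡ : ∀ {x x' y} → x ≅ x' → x ∈ᵥ y → x' ∈ᵥ y
∈-respˡ {y = sup B g} e (b , r) = b , ≅-trans (≅-sym e) r

∈-respʳ : ∀ {x y y'} → y ≅ y' → x ∈ᵥ y → x ∈ᵥ y'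
∈-respʳ {y = sup A f} {sup B g} (p , q) (a , r) = proj₁ (p a) , ≅-trans r (proj₂ (p a))

∈-resp : ∀ {x x' y y'} → x ≅ x' → y ≅ y' → x ∈ᵥ y → x' ∈ᵥ y'
∈-resp e e' m = ∈-respʳ e' (∈-respˡ e m)

≅-ext : ∀ {x y} → (∀ z → z ∈ᵥ x → z ∈ᵥ y) → (∀ z → z ∈ᵥ y → z ∈ᵥ x) → x ≅ y
≅-ext {sup A f} {sup B g} h k =
  (λ a → h (f a) (a , ≅-refl (f a))) ,
  (λ b → proj₁ (k (g b) (b , ≅-refl (g b))) , ≅-sym (proj₂ (k (g b) (b , ≅-refl (g b)))))

∈-irrefl : ∀ a → ¬ (a ∈ᵥ a)
∈-irrefl (sup A f) (i , r) = ∈-irrefl (f i) (∈-resp r r (i , r))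

∈-upair⁻ : ∀ {z x y} → z ∈ᵥ upair x y → z ≅ x ⊎ z ≅ y
∈-upair⁻ (true , r) = inj₁ r
∈-upair⁻ (false , r) = inj₂ r

∈-upair⁺ˡ : ∀ {z x y} → z ≅ x → z ∈ᵥ upair x y
∈-upair⁺ˡ r = true , r

∈-upair⁺ʳ : ∀ {z x y} → z ≅ y → z ∈ᵥ upair x y
∈-upair⁺ʳ r = false , r

∈-singleton⁻ : ∀ {z x} → z ∈ᵥ upair x x → z ≅ x
∈-singleton⁻ m with ∈-upair⁻ m
... | inj₁ r = r
... | inj₂ r = r

upair-cong : ∀ {x x' y y'} → x ≅ x' → y ≅ y' → upair x y ≅ upair x' y'
upair-cong {x} {x'} {y} {y'} ex ey = ≅-ext (λ _ m → forth (∈-upair⁻ m)) (λ _ m → back (∈-upair⁻ m))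
  where
  forth : ∀ {z} → z ≅ x ⊎ z ≅ y → z ∈ᵥ upair x' y'
  forth (inj₁ r) = ∈-upair⁺ˡ (≅-trans r ex)
  forth (inj₂ r) = ∈-upair⁺ʳ (≅-trans r ey)
  back : ∀ {z} → z ≅ x' ⊎ z ≅ y' → z ∈ᵥ upair x y
  back (inj₁ r) = ∈-upair⁺ˡ (≅-trans r (≅-sym ex))
  back (inj₂ r) = ∈-upair⁺ʳ (≅-trans r (≅-sym ey))

⟨,⟩-cong : ∀ {a a' b b'} → a ≅ a' → b ≅ b' → ⟨ a , b ⟩ ≅ ⟨ a' , b' ⟩
⟨,⟩-cong ea eb = upair-cong (upair-cong ea ea) (upair-cong ea eb)

singleton≅upair : ∀ {a c d} → upair a a ≅ upair c d → c ≅ a × d ≅ a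
singleton≅upair e =
  ∈-singleton⁻ (∈-respʳ (≅-sym e) (∈-upair⁺ˡ (≅-refl _))) ,
  ∈-singleton⁻ (∈-respʳ (≅-sym e) (∈-upair⁺ʳ (≅-refl _)))

upair-injectiveʳ : ∀ {a b c d} → upair a b ≅ upair c d → a ≅ c → b ≅ d
upair-injectiveʳ {a} {b} {c} {d} e ac with ∈-upair⁻ (∈-respʳ e (∈-upair⁺ʳ {b} {a} {b} (≅-refl b)))
... | inj₂ bd = bd
... | inj₁ bc with ∈-upair⁻ (∈-respʳ (≅-sym e) (∈-upair⁺ʳ {d} {c} {d} (≅-refl d)))
...   | inj₂ db = ≅-sym db
...   | inj₁ da = ≅-trans bc (≅-trans (≅-sym ac) (≅-sym da))

⟨,⟩-injective : ∀ {a b c d} → ⟨ a , b ⟩ ≅ ⟨ c , d ⟩ → a ≅ c × b ≅ d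
⟨,⟩-injective {a} {b} {c} {d} e = ac , bd
  where
  ac : a ≅ c
  ac with ∈-upair⁻ (∈-respʳ e (∈-upair⁺ˡ (≅-refl (upair a a))))
  ... | inj₁ r = ≅-sym (proj₁ (singleton≅upair r))
  ... | inj₂ r = ≅-sym (proj₁ (singleton≅upair r))
  bd : b ≅ d
  bd with ∈-upair⁻ (∈-respʳ e (∈-upair⁺ʳ {upair a b} {upair a a} (≅-refl _)))
  ... | inj₂ r = upair-injectiveʳ r ac
  ... | inj₁ r with ∈-upair⁻ (∈-respʳ (≅-sym e) (∈-upair⁺ʳ {upair c d} {upair c c} (≅-refl _)))
  ...   | inj₁ r' = ≅-trans (proj₂ (singleton≅upair (≅-sym r)))
                      (≅-trans (≅-sym ac) (≅-sym (proj₂ (singleton≅upair (≅-sym r')))))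
  ...   | inj₂ r' = ≅-sym (upair-injectiveʳ r' (≅-sym ac))

⟨,⟩-injectiveˡ : ∀ {a b c d} → ⟨ a , b ⟩ ≅ ⟨ c , d ⟩ → a ≅ c
⟨,⟩-injectiveˡ e = proj₁ (⟨,⟩-injective e)

⟨,⟩-injectiveʳ : ∀ {a b c d} → ⟨ a , b ⟩ ≅ ⟨ c , d ⟩ → b ≅ d
⟨,⟩-injectiveʳ e = proj₂ (⟨,⟩-injective e)

sep : V → (V → Set) → V
sep (sup A f) P = sup (Σ A λ i → P (f i)) (λ p → f (proj₁ p))

module _ (P : V → Set) (P-resp : ∀ {x y} → x ≅ y → P x → P y) where

  ∈-sep⁺ : ∀ a {z} → z ∈ᵥ a → P z → z ∈ᵥ sep a P
  ∈-sep⁺ (sup A f) (i , r) pz = (i , P-resp r pz) , r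

  ∈-sep⁻ : ∀ a {z} → z ∈ᵥ sep a P → (z ∈ᵥ a) × P z
  ∈-sep⁻ (sup A f) ((i , p) , r) = (i , r) , P-resp (≅-sym r) p

tupleGo-∷ʳ : ∀ {n} acc (as : Vec V n) a → tupleGo acc (as ∷ʳ a) ≡ ⟨ tupleGo acc as , a ⟩
tupleGo-∷ʳ acc [] a = refl
tupleGo-∷ʳ acc (b ∷ as) a = tupleGo-∷ʳ ⟨ acc , b ⟩ as a

tuple-∷ʳ : ∀ {n} (as : Vec V (suc n)) a → tuple (as ∷ʳ a) ≅ ⟨ tuple as , a ⟩
tuple-∷ʳ (b ∷ as) a = ≡⇒≅ (tupleGo-∷ʳ b as a)

tupleGo-injective : ∀ {n} {acc acc'} (as bs : Vec V n) → tupleGo acc as ≅ tupleGo acc' bs →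
                    acc ≅ acc' × Pointwise _≅_ as bs
tupleGo-injective [] [] e = e , []
tupleGo-injective (a ∷ as) (b ∷ bs) e with tupleGo-injective as bs e
... | e' , es = ⟨,⟩-injectiveˡ e' , ⟨,⟩-injectiveʳ e' ∷ es

tuple-injective : ∀ {n} (as bs : Vec V (suc n)) → tuple as ≅ tuple bs → Pointwise _≅_ as bs
tuple-injective (a ∷ as) (b ∷ bs) e with tupleGo-injective as bs e
... | ab , es = ab ∷ es

All-∷ʳ⁺ : ∀ {P : V → Set₁} {n} {as : Vec V n} {a} → All P as → P a → All P (as ∷ʳ a)
All-∷ʳ⁺ [] pa = pa ∷ []
All-∷ʳ⁺ (p ∷ ps) pa = p ∷ All-∷ʳ⁺ ps pa

All-∷ʳ⁻ : ∀ {P : V → Set₁} {n} (as : Vec V n) {a} → All P (as ∷ʳ a) → All P as × P a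
All-∷ʳ⁻ [] (pa ∷ []) = [] , pa
All-∷ʳ⁻ (b ∷ as) (pb ∷ ps) = let (pas , pa) = All-∷ʳ⁻ as ps in pb ∷ pas , pa

-- Closure of a universe under rudimentary operations

members : V → Cls
members a z = ⌞ z ∈ᵥ a ⌟

singleton : V → Cls
singleton x z = ⌞ z ≅ x ⌟

_×ᶜ_ : Cls → Cls → Cls
(C ×ᶜ D) c = Σ V λ u → Σ V λ w → C u × D w × ⌞ c ≅ ⟨ u , w ⟩ ⌟

⋃ᶜ : Cls → Cls
⋃ᶜ C z = Σ V λ y → C y × ⌞ z ∈ᵥ y ⌟

memberRel : Cls → Cls
memberRel C c = Σ V λ u → Σ V λ w → C u × C w × ⌞ u ∈ᵥ w ⌟ × ⌞ c ≅ ⟨ u , w ⟩ ⌟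

Power : ℕ → V → Cls
Power n X c = Σ (Vec V (suc n)) λ as → All (members X) as × ⌞ c ≅ tuple as ⌟

module Closure (lem : ExcludedMiddle (lsuc lzero)) {W : V → Set₁} (U : IsUniverse W) where
  open IsUniverse U

  set : ∀ {C} → C ∈W W → V
  set s = proj₁ s

  W-set : ∀ {C} (s : C ∈W W) → W (set s)
  W-set s = proj₁ (proj₂ s)

  set⁺ : ∀ {C} (s : C ∈W W) {z} → C z → z ∈ᵥ set s
  set⁺ s {z} c = lower (from (proj₂ (proj₂ s) z) c)

  set⁻ : ∀ {C} (s : C ∈W W) {z} → z ∈ᵥ set s → C z
  set⁻ s {z} m = to (proj₂ (proj₂ s) z) (lift m)

  -- Only the statements of the closure lemmas are ever needed, and keeping
  -- their proofs opaque keeps the later type-checking tractable.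
  opaque
    ∈W-resp : ∀ {C D : Cls} → C ∈W W → (∀ z → C z → D z) → (∀ z → D z → C z) → D ∈W W
    ∈W-resp s f g = set s , W-set s , λ z → mk⇔ (λ m → f z (set⁻ s (lower m))) (λ d → lift (set⁺ s (g z d)))

  ∈W-self : ∀ {a} → W a → members a ∈W W
  ∈W-self {a} wa = a , wa , λ z → mk⇔ (λ m → m) (λ m → m)

  opaque
    W-upair : ∀ {x y} → W x → W y → W (upair x y)
    W-upair {x} {y} wx wy =
      resp (≅-ext (λ _ m → forth (set⁻ (cl0 wx wy) m)) (λ _ m → set⁺ (cl0 wx wy) (back (∈-upair⁻ m))))
           (W-set (cl0 wx wy))
      where
      forth : ∀ {z} → F0 x y z → z ∈ᵥ upair x y
      forth (inj₁ (lift r)) = ∈-upair⁺ˡ r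
      forth (inj₂ (lift r)) = ∈-upair⁺ʳ r
      back : ∀ {z} → z ≅ x ⊎ z ≅ y → F0 x y z
      back (inj₁ r) = inj₁ (lift r)
      back (inj₂ r) = inj₂ (lift r)

  opaque
    ∈W-∪ : ∀ {C D} → C ∈W W → D ∈W W → (λ z → C z ⊎ D z) ∈W W
    ∈W-∪ {C} {D} s t = ∈W-resp (cl6 (W-upair (W-set s) (W-set t))) forth back
      where
      forth : ∀ z → F6 (upair (set s) (set t)) z → C z ⊎ D z
      forth z (y , lift m , lift n) with ∈-upair⁻ m
      ... | inj₁ r = inj₁ (set⁻ s (∈-respʳ r n))
      ... | inj₂ r = inj₂ (set⁻ t (∈-respʳ r n))
      back : ∀ z → C z ⊎ D z → F6 (upair (set s) (set t)) z
      back z (inj₁ c) = set s , lift (∈-upair⁺ˡ (≅-refl _)) , lift (set⁺ s c)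
      back z (inj₂ d) = set t , lift (∈-upair⁺ʳ (≅-refl _)) , lift (set⁺ t d)

  opaque
    ∈W-∖ : ∀ {C D} → C ∈W W → D ∈W W → (λ z → C z × ¬ D z) ∈W W
    ∈W-∖ s t = ∈W-resp (cl1 (W-set s) (W-set t))
      (λ z (lift m , n) → set⁻ s m , λ d → n (lift (set⁺ t d)))
      (λ z (c , n) → lift (set⁺ s c) , λ m → n (set⁻ t (lower m)))

  opaque
    ∈W-∩ : ∀ {C D} → C ∈W W → D ∈W W → (λ z → C z × D z) ∈W W
    ∈W-∩ {C} {D} s t = ∈W-resp (∈W-∖ s (∈W-∖ s t)) forth (λ z (c , d) → c , λ p → proj₂ p d)
      where
      forth : ∀ z → C z × ¬ (C z × ¬ D z) → C z × D z
      forth z (c , n) with lem {D z}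
      ... | yes d = c , d
      ... | no nd = ⊥-elim (n (c , nd))

  opaque
    ∈W-× : ∀ {C D} → C ∈W W → D ∈W W → (C ×ᶜ D) ∈W W
    ∈W-× s t = ∈W-resp (cl2 (W-set s) (W-set t))
      (λ c (u , w , lift mu , lift mw , e) → u , w , set⁻ s mu , set⁻ t mw , e)
      (λ c (u , w , cu , dw , e) → u , w , lift (set⁺ s cu) , lift (set⁺ t dw) , e)

  opaque
    ∈W-F3 : ∀ {C D} → C ∈W W → D ∈W W →
            (λ c → Σ V λ u → Σ V λ z → Σ V λ w → C z × D ⟨ u , w ⟩ × ⌞ c ≅ ⟨ ⟨ u , z ⟩ , w ⟩ ⌟) ∈W W
    ∈W-F3 s t = ∈W-resp (cl3 (W-set s) (W-set t))
      (λ c (u , z , w , lift mz , lift mp , e) → u , z , w , set⁻ s mz , set⁻ t mp , e)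
      (λ c (u , z , w , cz , dp , e) → u , z , w , lift (set⁺ s cz) , lift (set⁺ t dp) , e)

  opaque
    ∈W-F4 : ∀ {C D} → C ∈W W → D ∈W W →
            (λ c → Σ V λ u → Σ V λ z → Σ V λ w → C z × D ⟨ u , w ⟩ × ⌞ c ≅ ⟨ ⟨ z , w ⟩ , u ⟩ ⌟) ∈W W
    ∈W-F4 s t = ∈W-resp (cl4 (W-set s) (W-set t))
      (λ c (u , z , w , lift mz , lift mp , e) → u , z , w , set⁻ s mz , set⁻ t mp , e)
      (λ c (u , z , w , cz , dp , e) → u , z , w , lift (set⁺ s cz) , lift (set⁺ t dp) , e)

  opaque
    ∈W-⋃ : ∀ {C} → C ∈W W → ⋃ᶜ C ∈W W
    ∈W-⋃ s = ∈W-resp (cl6 (W-set s))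
      (λ z (y , lift m , n) → y , set⁻ s m , n)
      (λ z (y , c , n) → y , lift (set⁺ s c) , n)

  opaque
    ∈W-dom : ∀ {C} → C ∈W W → (λ z → Σ V λ w → C ⟨ z , w ⟩) ∈W W
    ∈W-dom s = ∈W-resp (cl7 (W-set s))
      (λ z (w , lift m) → w , set⁻ s m)
      (λ z (w , c) → w , lift (set⁺ s c))

  opaque
    ∈W-memberRel : ∀ {C} → C ∈W W → memberRel C ∈W W
    ∈W-memberRel s = ∈W-resp (cl8 (W-set s))
      (λ c (u , w , lift mu , lift mw , m , e) → u , w , set⁻ s mu , set⁻ s mw , m , e)
      (λ c (u , w , cu , cw , m , e) → u , w , lift (set⁺ s cu) , lift (set⁺ s cw) , m , e)

  opaque
    ∈W-singleton : ∀ {x} → W x → singleton x ∈W W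
    ∈W-singleton wx = ∈W-resp (cl0 wx wx) (λ z → [ (λ r → r) , (λ r → r) ]′) (λ z → inj₁)

  opaque
    ∈W-∋ : ∀ {C a} → C ∈W W → W a → (λ z → C z × ⌞ a ∈ᵥ z ⌟) ∈W W
    ∈W-∋ {C} {a} s wa = ∈W-resp (cl6 (W-set E)) forth back
      where
      C∪a : (λ z → C z ⊎ singleton a z) ∈W W
      C∪a = ∈W-∪ s (∈W-singleton wa)
      M : memberRel (λ z → C z ⊎ singleton a z) ∈W W
      M = ∈W-memberRel C∪a
      -- E = {{w ∈ C ∪ {a} : a ∈ w}}, so ⋃ E = {w ∈ C : a ∈ w} by foundation
      E : F5 (set M) (upair (upair a a) (upair a a)) ∈W W
      E = cl5 (W-set M) (W-upair (W-upair wa wa) (W-upair wa wa))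
      forth : ∀ z → F6 (set E) z → C z × ⌞ a ∈ᵥ z ⌟
      forth z (y , lift yE , lift zy) with set⁻ E yE
      ... | z0 , lift z0a , h with to (h z) (lift zy)
      ...   | u , lift uz0 , lift uzM with set⁻ M uzM
      ...     | u' , w' , _ , cw' , lift m , lift e = member (∈-resp u'a w'z m) cw'
        where
        u'a : u' ≅ a
        u'a = ≅-trans (≅-sym (⟨,⟩-injectiveˡ e)) (∈-singleton⁻ (∈-respʳ (∈-singleton⁻ z0a) uz0))
        w'z : w' ≅ z
        w'z = ≅-sym (⟨,⟩-injectiveʳ e)
        member : a ∈ᵥ z → C w' ⊎ singleton a w' → C z × ⌞ a ∈ᵥ z ⌟
        member az (inj₁ cw) = set⁻ s (∈-respˡ w'z (set⁺ s cw)) , lift az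
        member az (inj₂ (lift w'a)) = ⊥-elim (∈-irrefl a (∈-respʳ (≅-trans (≅-sym w'z) w'a) az))
      back : ∀ z → C z × ⌞ a ∈ᵥ z ⌟ → F6 (set E) z
      back z (cz , lift az) =
        c , lift (set⁺ E (upair a a , lift (∈-upair⁺ˡ (≅-refl _)) , λ w → mk⇔ (into w) (outof w))) ,
        lift (∈-sep⁺ (a ∈ᵥ_) ∈-respʳ (set C∪a) (set⁺ C∪a (inj₁ cz)) az)
        where
        c : V
        c = sep (set C∪a) (a ∈ᵥ_)
        into : ∀ w → ⌞ w ∈ᵥ c ⌟ → Σ V λ u → ⌞ u ∈ᵥ upair a a ⌟ × ⌞ ⟨ u , w ⟩ ∈ᵥ set M ⌟
        into w (lift m) with ∈-sep⁻ (a ∈ᵥ_) ∈-respʳ (set C∪a) m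
        ... | wM , aw = a , lift (∈-upair⁺ˡ (≅-refl _)) ,
                        lift (set⁺ M (a , w , inj₂ (lift (≅-refl a)) , set⁻ C∪a wM , lift aw , lift (≅-refl _)))
        outof : ∀ w → (Σ V λ u → ⌞ u ∈ᵥ upair a a ⌟ × ⌞ ⟨ u , w ⟩ ∈ᵥ set M ⌟) → ⌞ w ∈ᵥ c ⌟
        outof w (u , lift ua , lift uwM) with set⁻ M uwM
        ... | u' , w' , _ , cw' , lift m , lift e =
          lift (∈-sep⁺ (a ∈ᵥ_) ∈-respʳ (set C∪a) (∈-respˡ w'w (set⁺ C∪a cw'))
                  (∈-resp (≅-trans (≅-sym (⟨,⟩-injectiveˡ e)) (∈-singleton⁻ ua)) w'w m))
          where
          w'w : w' ≅ w
          w'w = ≅-sym (⟨,⟩-injectiveʳ e)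

  opaque
    ∈W-singletons : ∀ {A} → W A → (λ c → Σ V λ a → ⌞ a ∈ᵥ A ⌟ × ⌞ c ≅ upair a a ⌟) ∈W W
    ∈W-singletons {A} wA = ∈W-resp (∈W-∖ T (∈W-∋ T wA)) forth back
      where
      -- T = ⋃ (A × {A}) = {{a}, {a, A} : a ∈ A}; by foundation the singletons are
      -- exactly the members of T that do not contain A.
      T : ⋃ᶜ (members A ×ᶜ singleton A) ∈W W
      T = ∈W-⋃ (∈W-× (∈W-self wA) (∈W-singleton wA))
      forth : ∀ c → ⋃ᶜ (members A ×ᶜ singleton A) c × ¬ (⋃ᶜ (members A ×ᶜ singleton A) c × ⌞ A ∈ᵥ c ⌟) →
                    Σ V λ a → ⌞ a ∈ᵥ A ⌟ × ⌞ c ≅ upair a a ⌟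
      forth c (Tc@(y , (u , w , lift uA , lift wA' , lift e) , lift cy) , ∌A) with ∈-upair⁻ (∈-respʳ e cy)
      ... | inj₁ r = u , lift uA , lift r
      ... | inj₂ r = ⊥-elim (∌A (Tc , lift (∈-respʳ (≅-sym r) (∈-upair⁺ʳ (≅-sym wA')))))
      back : ∀ c → (Σ V λ a → ⌞ a ∈ᵥ A ⌟ × ⌞ c ≅ upair a a ⌟) →
                   ⋃ᶜ (members A ×ᶜ singleton A) c × ¬ (⋃ᶜ (members A ×ᶜ singleton A) c × ⌞ A ∈ᵥ c ⌟)
      back c (a , lift aA , lift e) =
        (⟨ a , A ⟩ , (a , A , lift aA , lift (≅-refl A) , lift (≅-refl _)) , lift (∈-upair⁺ˡ e)) ,
        λ (_ , lift Ac) → ∈-irrefl A (∈-respˡ (≅-sym (∈-singleton⁻ (∈-respʳ e Ac))) aA)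

  opaque
    ∈W-diagonal : ∀ {A} → W A → (λ c → Σ V λ a → ⌞ a ∈ᵥ A ⌟ × ⌞ c ≅ ⟨ a , a ⟩ ⌟) ∈W W
    ∈W-diagonal {A} wA = ∈W-resp (∈W-singletons (W-set (∈W-singletons wA))) forth back
      where
      forth : ∀ c → (Σ V λ s → ⌞ s ∈ᵥ set (∈W-singletons wA) ⌟ × ⌞ c ≅ upair s s ⌟) →
                    Σ V λ a → ⌞ a ∈ᵥ A ⌟ × ⌞ c ≅ ⟨ a , a ⟩ ⌟
      forth c (s , lift sS , lift e) with set⁻ (∈W-singletons wA) sS
      ... | a , aA , lift e' = a , aA , lift (≅-trans e (upair-cong e' e'))
      back : ∀ c → (Σ V λ a → ⌞ a ∈ᵥ A ⌟ × ⌞ c ≅ ⟨ a , a ⟩ ⌟) →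
                   Σ V λ s → ⌞ s ∈ᵥ set (∈W-singletons wA) ⌟ × ⌞ c ≅ upair s s ⌟
      back c (a , aA , lift e) = upair a a , lift (set⁺ (∈W-singletons wA) (a , aA , lift (≅-refl _))) , lift e

  ∈W-power : ∀ n {X} → W X → Power n X ∈W W
  ∈W-power zero {X} wX = ∈W-resp (∈W-self wX) (λ c m → c ∷ [] , m ∷ [] , lift (≅-refl c)) back
    where
    back : ∀ c → Power zero X c → members X c
    back c (a ∷ [] , lift m ∷ [] , lift e) = lift (∈-respˡ (≅-sym e) m)
  ∈W-power (suc n) {X} wX = ∈W-resp (∈W-× (∈W-power n wX) (∈W-self wX)) forth back
    where
    forth : ∀ c → (Power n X ×ᶜ members X) c → Power (suc n) X c
    forth c (u , a , (as , al , lift u≅as) , aX , lift c≅ua) =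
      as ∷ʳ a , All-∷ʳ⁺ al aX ,
      lift (≅-trans c≅ua (≅-trans (⟨,⟩-cong u≅as (≅-refl a)) (≅-sym (tuple-∷ʳ as a))))
    back : ∀ c → Power (suc n) X c → (Power n X ×ᶜ members X) c
    back c (as , al , lift e) with initLast as
    ... | as₀ , a , refl with All-∷ʳ⁻ as₀ al
    ...   | al₀ , aX = tuple as₀ , a , (as₀ , al₀ , lift (≅-refl _)) , aX , lift (≅-trans e (tuple-∷ʳ as₀ a))

-- Assignments and the coincidence lemma

≡ᵇ-refl : ∀ x → (x ≡ᵇ x) ≡ true
≡ᵇ-refl zero = refl
≡ᵇ-refl (suc x) = ≡ᵇ-refl x

≢⇒≡ᵇ-false : ∀ {z x} → z ≢ x → (z ≡ᵇ x) ≡ false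
≢⇒≡ᵇ-false {zero} {zero} z≢x = ⊥-elim (z≢x refl)
≢⇒≡ᵇ-false {zero} {suc x} z≢x = refl
≢⇒≡ᵇ-false {suc z} {zero} z≢x = refl
≢⇒≡ᵇ-false {suc z} {suc x} z≢x = ≢⇒≡ᵇ-false (λ e → z≢x (cong suc e))

[≔]-same : ∀ (w : Assignment) x a → (w [ x ≔ a ]) x ≡ a
[≔]-same w x a rewrite ≡ᵇ-refl x = refl

[≔]-other : ∀ (w : Assignment) {x z} a → z ≢ x → (w [ x ≔ a ]) z ≡ w z
[≔]-other w a z≢x rewrite ≢⇒≡ᵇ-false z≢x = refl

[≔]-self : ∀ (w : Assignment) x z → (w [ x ≔ w x ]) z ≡ w z
[≔]-self w x z with z ≟ x
... | yes refl = [≔]-same w z (w z)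
... | no z≢x = [≔]-other w (w x) z≢x

∈-rm⁻ : ∀ {z y} L → z ∈ℓ rm y L → z ∈ℓ L × z ≢ y
∈-rm⁻ {z} {y} (u ∷ L) m with u ≟ y
∈-rm⁻ {z} {y} (u ∷ L) m | yes refl rewrite ≡ᵇ-refl u = let (zL , z≢y) = ∈-rm⁻ L m in there zL , z≢y
∈-rm⁻ {z} {y} (u ∷ L) m | no u≢y rewrite ≢⇒≡ᵇ-false u≢y with m
... | here refl = here refl , u≢y
... | there m' = let (zL , z≢y) = ∈-rm⁻ L m' in there zL , z≢y

∈-rm⁺ : ∀ {z y} L → z ∈ℓ L → z ≢ y → z ∈ℓ rm y L
∈-rm⁺ {z} {y} (u ∷ L) m z≢y with u ≟ y
∈-rm⁺ {z} {y} (u ∷ L) (here refl) z≢y | yes refl = ⊥-elim (z≢y refl)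
∈-rm⁺ {z} {y} (u ∷ L) (there m) z≢y | yes refl rewrite ≡ᵇ-refl u = ∈-rm⁺ L m z≢y
∈-rm⁺ {z} {y} (u ∷ L) m z≢y | no u≢y rewrite ≢⇒≡ᵇ-false u≢y with m
... | here refl = here refl
... | there m' = there (∈-rm⁺ L m' z≢y)

infix 4 _≋_

_≋_ : Assignment → Assignment → Set
w ≋ w' = ∀ z → w z ≅ w' z

≋-refl : ∀ {w} → w ≋ w
≋-refl {w} z = ≅-refl (w z)

≋-sym : ∀ {w w'} → w ≋ w' → w' ≋ w
≋-sym p z = ≅-sym (p z)

≡⇒≋ : ∀ {w w'} → (∀ z → w z ≡ w' z) → w ≋ w'
≡⇒≋ h z = ≡⇒≅ (h z)

≋-[≔] : ∀ {w w'} y {a b} → w ≋ w' → a ≅ b → (w [ y ≔ a ]) ≋ (w' [ y ≔ b ])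
≋-[≔] {w} {w'} y {a} {b} w≋w' a≅b z with z ≟ y
... | yes refl rewrite [≔]-same w z a | [≔]-same w' z b = a≅b
... | no z≢y rewrite [≔]-other w a z≢y | [≔]-other w' b z≢y = w≋w' z

≋-[≔*] : ∀ {n w w'} (ys : Vec Var n) {as bs : Vec V n} → w ≋ w' → Pointwise _≅_ as bs →
         (w [ ys ≔* as ]) ≋ (w' [ ys ≔* bs ])
≋-[≔*] [] w≋w' [] = w≋w'
≋-[≔*] (y ∷ ys) w≋w' (a≅b ∷ as≅bs) = ≋-[≔*] ys (≋-[≔] y w≋w' a≅b) as≅bs

[≔*]-∷ʳ : ∀ {n} (w : Assignment) (ys : Vec Var n) (as : Vec V n) y a →
          (w [ ys ∷ʳ y ≔* as ∷ʳ a ]) ≋ ((w [ ys ≔* as ]) [ y ≔ a ])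
[≔*]-∷ʳ w [] [] y a = ≋-refl
[≔*]-∷ʳ w (y' ∷ ys) (a' ∷ as) y a = [≔*]-∷ʳ (w [ y' ≔ a' ]) ys as y a

[≔*]-++ : ∀ {n k} (w : Assignment) (ys : Vec Var n) (as : Vec V n) (zs : Vec Var k) (bs : Vec V k) z →
          (w [ ys ++ᵛ zs ≔* as ++ᵛ bs ]) z ≡ ((w [ ys ≔* as ]) [ zs ≔* bs ]) z
[≔*]-++ w [] [] zs bs z = refl
[≔*]-++ w (y ∷ ys) (a ∷ as) zs bs z = [≔*]-++ (w [ y ≔ a ]) ys as zs bs z

[≔*]-outside : ∀ {n} (w : Assignment) (ys : Vec Var n) (as : Vec V n) {z} →
               ¬ (z ∈ℓ toList ys) → (w [ ys ≔* as ]) z ≡ w z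
[≔*]-outside w [] [] z∉ys = refl
[≔*]-outside w (y ∷ ys) (a ∷ as) {z} z∉ys with z ≟ y
... | yes refl = ⊥-elim (z∉ys (here refl))
... | no z≢y = trans ([≔*]-outside (w [ y ≔ a ]) ys as (λ m → z∉ys (there m))) ([≔]-other w a z≢y)

Agree : List Var → Assignment → Assignment → Set
Agree L w w' = ∀ z → z ∈ℓ L → w z ≅ w' z

Agree-sym : ∀ {L w w'} → Agree L w w' → Agree L w' w
Agree-sym ag z m = ≅-sym (ag z m)

Agree-++ˡ : ∀ {L M w w'} → Agree (L ++ M) w w' → Agree L w w'
Agree-++ˡ ag z m = ag z (∈-++⁺ˡ m)

Agree-++ʳ : ∀ L {M w w'} → Agree (L ++ M) w w' → Agree M w w'
Agree-++ʳ L ag z m = ag z (∈-++⁺ʳ L m)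

Agree-[≔] : ∀ {x L w w' a a'} → Agree (rm x L) w w' → a ≅ a' → Agree L (w [ x ≔ a ]) (w' [ x ≔ a' ])
Agree-[≔] {x} {L} {w} {w'} {a} {a'} ag a≅a' z m with z ≟ x
... | yes refl rewrite [≔]-same w z a | [≔]-same w' z a' = a≅a'
... | no z≢x rewrite [≔]-other w a z≢x | [≔]-other w' a' z≢x = ag z (∈-rm⁺ L m z≢x)

Agree-fresh : ∀ {x} L (w : Assignment) a → ¬ (x ∈ℓ L) → Agree L w (w [ x ≔ a ])
Agree-fresh {x} L w a x∉L z m with z ≟ x
... | yes refl = ⊥-elim (x∉L m)
... | no z≢x = ≡⇒≅ (sym ([≔]-other w a z≢x))

[≔*]-∷ʳ-last : ∀ {n} (w : Assignment) (ys : Vec Var n) (as : Vec V n) y a →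
               (w [ ys ∷ʳ y ≔* as ∷ʳ a ]) y ≅ a
[≔*]-∷ʳ-last w ys as y a = ≅-trans ([≔*]-∷ʳ w ys as y a y) (≡⇒≅ ([≔]-same (w [ ys ≔* as ]) y a))

[≔*]-∷ʳ-other : ∀ {n} (w : Assignment) (ys : Vec Var n) (as : Vec V n) {y} a {z} → z ≢ y →
                (w [ ys ∷ʳ y ≔* as ∷ʳ a ]) z ≅ (w [ ys ≔* as ]) z
[≔*]-∷ʳ-other w ys as {y} a {z} z≢y =
  ≅-trans ([≔*]-∷ʳ w ys as y a z) (≡⇒≅ ([≔]-other (w [ ys ≔* as ]) a z≢y))

[≔*]-map : ∀ {n} (u f : Assignment) (zs : Vec Var n) {z} → z ∈ℓ toList zs → (u [ zs ≔* map f zs ]) z ≡ f z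
[≔*]-map u f (z' ∷ zs) {z} m with z ∈? toList zs
... | yes m' = [≔*]-map (u [ z' ≔ f z' ]) f zs m'
... | no z∉zs with m
...   | there m' = ⊥-elim (z∉zs m')
...   | here refl = trans ([≔*]-outside (u [ z ≔ f z ]) zs (map f zs) z∉zs) ([≔]-same u z (f z))

All≢⇒∉ : ∀ {n} {y : Var} {ys : Vec Var n} → All (λ z → ¬ y ≡ z) ys → ¬ (y ∈ℓ toList ys)
All≢⇒∉ (y≢z ∷ _) (here y≡z) = y≢z y≡z
All≢⇒∉ (_ ∷ y≢zs) (there m) = All≢⇒∉ y≢zs m

All-[≔*] : ∀ {P : V → Set₁} {n} (w : Assignment) (ys : Vec Var n) (as : Vec V n) → Unique ys →
           (∀ y → y ∈ℓ toList ys → P ((w [ ys ≔* as ]) y)) → All P as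
All-[≔*] w [] [] [] _ = []
All-[≔*] {P} w (y ∷ ys) (a ∷ as) (y∉ys ∷ unique) h =
  subst P (trans ([≔*]-outside (w [ y ≔ a ]) ys as (All≢⇒∉ y∉ys)) ([≔]-same w y a)) (h y (here refl)) ∷
  All-[≔*] (w [ y ≔ a ]) ys as unique (λ y' m → h y' (there m))

IsHF-resp : ∀ {x y} → x ≅ y → IsHF x → IsHF y
IsHF-resp {x} {y} e (hf .x xs all h) = hf y xs all λ z →
  mk⇔ (λ m → to (h z) (lift (∈-respʳ (≅-sym e) (lower m))))
      (λ a → lift (∈-respʳ e (lower (from (h z) a))))

module Coincidence {W : V → Set₁} (W-resp : ∀ {x y} → x ≅ y → W x → W y) where
  open Semantics W

  coincidenceT : ∀ t {w w'} → Agree (FvT t) w w' → ∀ {z z'} → z ≅ z' → ‖ t ‖t w z → ‖ t ‖t w' z'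
  coincidenceF : ∀ φ {w w'} → Agree (FvF φ) w w' → ‖ φ ‖f w → ‖ φ ‖f w'

  coincidenceT (var x) ag e (lift m) = lift (∈-resp e (ag x (here refl)) m)
  coincidenceT HF ag e p = IsHF-resp e p
  coincidenceT (abs x φ _) ag e (wz , p) = W-resp e wz , coincidenceF φ (Agree-[≔] ag e) p

  coincidenceF (t ≐ s) ag h z = mk⇔
    (λ p → coincidenceT s (Agree-++ʳ (FvT t) ag) (≅-refl z)
             (to (h z) (coincidenceT t (Agree-sym (Agree-++ˡ ag)) (≅-refl z) p)))
    (λ p → coincidenceT t (Agree-++ˡ ag) (≅-refl z)
             (from (h z) (coincidenceT s (Agree-sym (Agree-++ʳ (FvT t) ag)) (≅-refl z) p)))
  coincidenceF (t ∈' s) ag (a , h , sa) = a ,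
    (λ z → mk⇔ (λ m → coincidenceT t (Agree-++ˡ ag) (≅-refl z) (to (h z) m))
               (λ p → from (h z) (coincidenceT t (Agree-sym (Agree-++ˡ ag)) (≅-refl z) p))) ,
    coincidenceT s (Agree-++ʳ (FvT t) ag) (≅-refl a) sa
  coincidenceF (¬' φ) ag n p = n (coincidenceF φ (Agree-sym ag) p)
  coincidenceF (φ ∧' ψ) ag (p , q) = coincidenceF φ (Agree-++ˡ ag) p , coincidenceF ψ (Agree-++ʳ (FvF φ) ag) q
  coincidenceF (φ ∨' ψ) ag (inj₁ p) = inj₁ (coincidenceF φ (Agree-++ˡ ag) p)
  coincidenceF (φ ∨' ψ) ag (inj₂ q) = inj₂ (coincidenceF ψ (Agree-++ʳ (FvF φ) ag) q)
  coincidenceF (∃' x φ) ag (a , wa , p) = a , wa , coincidenceF φ (Agree-[≔] ag (≅-refl a)) p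

  ‖‖t-resp : ∀ t {w w'} → w ≋ w' → ∀ {z z'} → z ≅ z' → ‖ t ‖t w z → ‖ t ‖t w' z'
  ‖‖t-resp t w≋w' = coincidenceT t (λ z _ → w≋w' z)

  ‖‖f-resp : ∀ φ {w w'} → w ≋ w' → ‖ φ ‖f w → ‖ φ ‖f w'
  ‖‖f-resp φ w≋w' = coincidenceF φ (λ z _ → w≋w' z)

-- Separable relations on the parameters

module Separation (lem : ExcludedMiddle (lsuc lzero)) {W : V → Set₁} (U : IsUniverse W)
                  (v : Assignment) (v∈W : ∀ x → W (v x)) where
  open IsUniverse U using (resp) renaming (trans to W-trans)
  open Closure lem U public
  open SetoidReasoning ≅-setoid

  Tuples : V → ∀ {n} → Vec Var (suc n) → (Assignment → Set₁) → Cls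
  Tuples X {n} ys P c = Σ (Vec V (suc n)) λ as → All (members X) as × ⌞ c ≅ tuple as ⌟ × P (v [ ys ≔* as ])

  record SeparableOn (X : V) {n} (ys : Vec Var (suc n)) (P : Assignment → Set₁) : Set₁ where
    constructor separable
    field tuples∈W : Tuples X ys P ∈W W
  open SeparableOn public

  Separable : (Assignment → Set₁) → Set₁
  Separable P = ∀ {n} (ys : Vec Var (suc n)) {X} → W X → SeparableOn X ys P

  Resp : (Assignment → Set₁) → Set₁
  Resp P = ∀ {w w'} → w ≋ w' → P w → P w'

  Resp-¬ : ∀ {P} → Resp P → Resp (λ w → ¬ P w)
  Resp-¬ P-resp w≋w' ¬p p = ¬p (P-resp (≋-sym w≋w') p)

  Resp-× : ∀ {P Q} → Resp P → Resp Q → Resp (λ w → P w × Q w)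
  Resp-× P-resp Q-resp w≋w' (p , q) = P-resp w≋w' p , Q-resp w≋w' q

  Resp-⊎ : ∀ {P Q} → Resp P → Resp Q → Resp (λ w → P w ⊎ Q w)
  Resp-⊎ P-resp Q-resp w≋w' (inj₁ p) = inj₁ (P-resp w≋w' p)
  Resp-⊎ P-resp Q-resp w≋w' (inj₂ q) = inj₂ (Q-resp w≋w' q)

  Resp-∃∈ : ∀ {Q} x Y → Resp Q → Resp (λ w → Σ V λ a → ⌞ a ∈ᵥ Y ⌟ × Q (w [ x ≔ a ]))
  Resp-∃∈ x Y Q-resp w≋w' (a , a∈Y , q) = a , a∈Y , Q-resp (≋-[≔] x w≋w' (≅-refl a)) q

  Resp-∈ᶜ : ∀ x c → Resp (λ w → ⌞ w x ∈ᵥ c ⌟)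
  Resp-∈ᶜ x c w≋w' (lift m) = lift (∈-respˡ (w≋w' x) m)

  Values : V → Var → Cls
  Values X z c = members X c ⊎ singleton (v z) c

  ∈W-values : ∀ {X} → W X → ∀ z → Values X z ∈W W
  ∈W-values wX z = ∈W-∪ (∈W-self wX) (∈W-singleton (v∈W z))

  [≔*]-values : ∀ {n} (ys : Vec Var n) (as : Vec V n) {X} z → All (members X) as → Values X z ((v [ ys ≔* as ]) z)
  [≔*]-values ys as {X} z al = go v ys as al (inj₂ (lift (≅-refl (v z))))
    where
    go : ∀ {n} (w : Assignment) (ys : Vec Var n) (as : Vec V n) → All (members X) as →
         Values X z (w z) → Values X z ((w [ ys ≔* as ]) z)
    go w [] [] [] val = val
    go w (y ∷ ys) (a ∷ as) (aX ∷ al) val = go (w [ y ≔ a ]) ys as al (step w y a aX val)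
      where
      step : ∀ w y a → members X a → Values X z (w z) → Values X z ((w [ y ≔ a ]) z)
      step w y a aX val with z ≟ y
      ... | yes refl rewrite [≔]-same w z a = inj₁ aX
      ... | no z≢y rewrite [≔]-other w a z≢y = val

  W-[≔*] : ∀ {n} (ys : Vec Var (suc n)) as {X} → W X → All (members X) as → ∀ x → W ((v [ ys ≔* as ]) x)
  W-[≔*] ys as wX al x with [≔*]-values ys as x al
  ... | inj₁ (lift m) = W-trans wX m
  ... | inj₂ (lift e) = resp (≅-sym e) (v∈W x)

  Tuples-unique : ∀ {P n} {ys : Vec Var (suc n)} {X c} → Resp P → Tuples X ys P c →
                  ∀ as → ⌞ c ≅ tuple as ⌟ → P (v [ ys ≔* as ])
  Tuples-unique {ys = ys} P-resp (as' , _ , lift c≅as' , p) as (lift c≅as) =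
    P-resp (≋-[≔*] ys ≋-refl (tuple-injective as' as (≅-trans (≅-sym c≅as') c≅as))) p

  separable-resp : ∀ {P P' : Assignment → Set₁} {n} {ys : Vec Var (suc n)} {X} →
    (∀ as → All (members X) as → P (v [ ys ≔* as ]) → P' (v [ ys ≔* as ])) →
    (∀ as → All (members X) as → P' (v [ ys ≔* as ]) → P (v [ ys ≔* as ])) →
    SeparableOn X ys P → SeparableOn X ys P'
  separable-resp f g (separable s) =
    separable (∈W-resp s (λ c (as , al , e , p) → as , al , e , f as al p)
                         (λ c (as , al , e , p) → as , al , e , g as al p))

  separable-¬ : ∀ {P n} {ys : Vec Var (suc n)} {X} → W X → Resp P →
                SeparableOn X ys P → SeparableOn X ys (λ w → ¬ P w)
  separable-¬ {n = n} {ys} wX P-resp (separable s) = separable (∈W-resp (∈W-∖ (∈W-power n wX) s)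
    (λ c ((as , al , e) , ∉s) → as , al , e , λ p → ∉s (as , al , e , p))
    (λ c (as , al , e , ¬p) → (as , al , e) , λ t → ¬p (Tuples-unique {ys = ys} P-resp t as e)))

  separable-∧ : ∀ {P Q n} {ys : Vec Var (suc n)} {X} → Resp Q →
                SeparableOn X ys P → SeparableOn X ys Q → SeparableOn X ys (λ w → P w × Q w)
  separable-∧ {ys = ys} Q-resp (separable s) (separable t) = separable (∈W-resp (∈W-∩ s t)
    (λ c ((as , al , e , p) , q) → as , al , e , p , Tuples-unique {ys = ys} Q-resp q as e)
    (λ c (as , al , e , p , q) → (as , al , e , p) , (as , al , e , q)))

  separable-⊎ : ∀ {P Q n} {ys : Vec Var (suc n)} {X} →
                SeparableOn X ys P → SeparableOn X ys Q → SeparableOn X ys (λ w → P w ⊎ Q w)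
  separable-⊎ (separable s) (separable t) = separable (∈W-resp (∈W-∪ s t) forth back)
    where
    forth : ∀ c → _ → _
    forth c (inj₁ (as , al , e , p)) = as , al , e , inj₁ p
    forth c (inj₂ (as , al , e , q)) = as , al , e , inj₂ q
    back : ∀ c → _ → _
    back c (as , al , e , inj₁ p) = inj₁ (as , al , e , p)
    back c (as , al , e , inj₂ q) = inj₂ (as , al , e , q)

  Graph : Var → ∀ {n} → Vec Var (suc n) → V → Cls
  Graph x {n} ys X c = Σ (Vec V (suc n)) λ as → All (members X) as × ⌞ c ≅ ⟨ tuple as , (v [ ys ≔* as ]) x ⟩ ⌟

  -- Induction on the last parameter y: the value of x is the new coordinate
  -- when x = y (built with F4 and the diagonal) and is unchanged otherwise (F3).
  ∈W-graph : ∀ x {n} (ys : Vec Var (suc n)) {X} → W X → Graph x ys X ∈W W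
  ∈W-graph x {zero} (y ∷ []) {X} wX with x ≟ y
  ... | yes refl = ∈W-resp (∈W-diagonal wX)
    (λ c (a , aX , lift c≅aa) → a ∷ [] , aX ∷ [] ,
       lift (≅-trans c≅aa (⟨,⟩-cong (≅-refl a) (≡⇒≅ (sym ([≔]-same v x a))))))
    (λ { c (a ∷ [] , aX ∷ [] , lift e) →
       a , aX , lift (≅-trans e (⟨,⟩-cong (≅-refl a) (≡⇒≅ ([≔]-same v x a)))) })
  ... | no x≢y = ∈W-resp (∈W-× (∈W-self wX) (∈W-singleton (v∈W x)))
    (λ c (a , b , aX , lift b≅vx , lift c≅ab) → a ∷ [] , aX ∷ [] ,
       lift (≅-trans c≅ab (⟨,⟩-cong (≅-refl a) (≅-trans b≅vx (≅-sym (≡⇒≅ ([≔]-other v a x≢y)))))))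
    (λ { c (a ∷ [] , aX ∷ [] , lift e) →
       a , v x , aX , lift (≅-refl _) , lift (≅-trans e (⟨,⟩-cong (≅-refl a) (≡⇒≅ ([≔]-other v a x≢y)))) })
  ∈W-graph x {suc n} ys {X} wX with initLast ys
  ... | ys₀ , y , refl with x ≟ y
  ...   | yes refl = ∈W-resp (∈W-F4 (∈W-power n wX) (∈W-diagonal wX)) forth back
    where
    forth : ∀ c → _ → Graph x (ys₀ ∷ʳ x) X c
    forth c (u , z , w , (as₀ , al₀ , lift z≅as₀) , (b , bX , lift uw≅bb) , lift e) =
      as₀ ∷ʳ b , All-∷ʳ⁺ al₀ bX , lift (begin
        c
          ≈⟨ e ⟩
        ⟨ ⟨ z , w ⟩ , u ⟩
          ≈⟨ ⟨,⟩-cong (⟨,⟩-cong z≅as₀ (⟨,⟩-injectiveʳ uw≅bb)) (⟨,⟩-injectiveˡ uw≅bb) ⟩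
        ⟨ ⟨ tuple as₀ , b ⟩ , b ⟩
          ≈⟨ ⟨,⟩-cong (≅-sym (tuple-∷ʳ as₀ b)) (≅-sym ([≔*]-∷ʳ-last v ys₀ as₀ x b)) ⟩
        ⟨ tuple (as₀ ∷ʳ b) , (v [ ys₀ ∷ʳ x ≔* as₀ ∷ʳ b ]) x ⟩
          ∎)
    back : ∀ c → Graph x (ys₀ ∷ʳ x) X c → _
    back c (as , al , lift e) with initLast as
    ... | as₀ , a , refl with All-∷ʳ⁻ as₀ al
    ...   | al₀ , aX =
      a , tuple as₀ , a , (as₀ , al₀ , lift (≅-refl _)) , (a , aX , lift (≅-refl _)) , lift (begin
        c
          ≈⟨ e ⟩
        ⟨ tuple (as₀ ∷ʳ a) , (v [ ys₀ ∷ʳ x ≔* as₀ ∷ʳ a ]) x ⟩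
          ≈⟨ ⟨,⟩-cong (tuple-∷ʳ as₀ a) ([≔*]-∷ʳ-last v ys₀ as₀ x a) ⟩
        ⟨ ⟨ tuple as₀ , a ⟩ , a ⟩
          ∎)
  ...   | no x≢y = ∈W-resp (∈W-F3 (∈W-self wX) (∈W-graph x ys₀ wX)) forth back
    where
    forth : ∀ c → _ → Graph x (ys₀ ∷ʳ y) X c
    forth c (u , z , w , zX , (as₀ , al₀ , lift uw≅) , lift e) =
      as₀ ∷ʳ z , All-∷ʳ⁺ al₀ zX , lift (begin
        c
          ≈⟨ e ⟩
        ⟨ ⟨ u , z ⟩ , w ⟩
          ≈⟨ ⟨,⟩-cong (⟨,⟩-cong (⟨,⟩-injectiveˡ uw≅) (≅-refl z)) (⟨,⟩-injectiveʳ uw≅) ⟩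
        ⟨ ⟨ tuple as₀ , z ⟩ , (v [ ys₀ ≔* as₀ ]) x ⟩
          ≈⟨ ⟨,⟩-cong (≅-sym (tuple-∷ʳ as₀ z)) (≅-sym ([≔*]-∷ʳ-other v ys₀ as₀ z x≢y)) ⟩
        ⟨ tuple (as₀ ∷ʳ z) , (v [ ys₀ ∷ʳ y ≔* as₀ ∷ʳ z ]) x ⟩
          ∎)
    back : ∀ c → Graph x (ys₀ ∷ʳ y) X c → _
    back c (as , al , lift e) with initLast as
    ... | as₀ , a , refl with All-∷ʳ⁻ as₀ al
    ...   | al₀ , aX =
      tuple as₀ , a , (v [ ys₀ ≔* as₀ ]) x , aX , (as₀ , al₀ , lift (≅-refl _)) , lift (begin
        c
          ≈⟨ e ⟩
        ⟨ tuple (as₀ ∷ʳ a) , (v [ ys₀ ∷ʳ y ≔* as₀ ∷ʳ a ]) x ⟩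
          ≈⟨ ⟨,⟩-cong (tuple-∷ʳ as₀ a) ([≔*]-∷ʳ-other v ys₀ as₀ a x≢y) ⟩
        ⟨ ⟨ tuple as₀ , a ⟩ , (v [ ys₀ ≔* as₀ ]) x ⟩
          ∎)

  separable-⟨,⟩∈ : ∀ x y {n} (ys : Vec Var (suc n)) {X R} → W X → W R →
                   SeparableOn X ys (λ w → ⌞ ⟨ w x , w y ⟩ ∈ᵥ R ⌟)
  separable-⟨,⟩∈ x y {n} ys {X} {R} wX wR = separable (∈W-resp (∈W-dom (∈W-∩ Gy Q)) forth back)
    where
    Gy = ∈W-graph y ys wX
    -- T₁ = {⟨⟨t, b⟩, w x⟩ : b ∈ X ∪ {v y}},  T₂ = {⟨⟨t, b⟩, a⟩ : t ∈ Xⁿ, ⟨a, b⟩ ∈ R}  (t = tuple as)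
    T₁ = ∈W-F3 (∈W-values wX y) (∈W-graph x ys wX)
    T₂ = ∈W-F4 (∈W-power n wX) (∈W-self wR)
    -- Q = {⟨t, b⟩ : ⟨w x, b⟩ ∈ R}, so the domain of Gy ∩ Q is {t : ⟨w x, w y⟩ ∈ R}
    Q = ∈W-dom (∈W-∩ T₁ T₂)
    forth : ∀ t → _ → Tuples X ys (λ w → ⌞ ⟨ w x , w y ⟩ ∈ᵥ R ⌟) t
    forth t (c , (as , al , lift tc≅) , (b , (u₁ , z₁ , w₁ , _ , (as₁ , _ , lift u₁w₁≅) , lift e₁) ,
                                           (u₂ , z₂ , w₂ , _ , lift u₂w₂R , lift e₂))) =
      as , al , lift (⟨,⟩-injectiveˡ tc≅) , lift (∈-respˡ (⟨,⟩-cong u₂≅vx w₂≅vy) u₂w₂R)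
      where
      e₁' = ⟨,⟩-injective e₁
      e₂' = ⟨,⟩-injective e₂
      as₁≅as : Pointwise _≅_ as₁ as
      as₁≅as = tuple-injective as₁ as (≅-trans (≅-sym (⟨,⟩-injectiveˡ u₁w₁≅))
                                       (≅-trans (≅-sym (⟨,⟩-injectiveˡ (proj₁ e₁'))) (⟨,⟩-injectiveˡ tc≅)))
      u₂≅vx : u₂ ≅ (v [ ys ≔* as ]) x
      u₂≅vx = ≅-trans (≅-sym (proj₂ e₂')) (≅-trans (proj₂ e₁')
                (≅-trans (⟨,⟩-injectiveʳ u₁w₁≅) (≋-[≔*] ys ≋-refl as₁≅as x)))
      w₂≅vy : w₂ ≅ (v [ ys ≔* as ]) y
      w₂≅vy = ≅-trans (≅-sym (⟨,⟩-injectiveʳ (proj₁ e₂'))) (⟨,⟩-injectiveʳ tc≅)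
    back : ∀ t → Tuples X ys (λ w → ⌞ ⟨ w x , w y ⟩ ∈ᵥ R ⌟) t → _
    back t (as , al , lift t≅as , lift r) =
      vy , (as , al , lift (⟨,⟩-cong t≅as (≅-refl vy))) ,
      (vx , (tuple as , vy , vx , [≔*]-values ys as y al , (as , al , lift (≅-refl _)) ,
             lift (⟨,⟩-cong (⟨,⟩-cong t≅as (≅-refl vy)) (≅-refl vx))) ,
            (vx , t , vy , (as , al , lift t≅as) , lift r , lift (≅-refl _)))
      where
      vx = (v [ ys ≔* as ]) x
      vy = (v [ ys ≔* as ]) y

  separable-∈ᶜ : ∀ x {n} (ys : Vec Var (suc n)) {X c} → W X → W c → SeparableOn X ys (λ w → ⌞ w x ∈ᵥ c ⌟)
  separable-∈ᶜ x ys {X} {c} wX wc = separable-resp {λ w → ⌞ ⟨ w x , w x ⟩ ∈ᵥ set Δ ⌟} {ys = ys}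
    (λ as al (lift m) → forth (set⁻ Δ m)) (λ as al (lift m) → lift (set⁺ Δ (_ , lift m , lift (≅-refl _))))
    (separable-⟨,⟩∈ x x ys wX (W-set Δ))
    where
    Δ = ∈W-diagonal wc
    forth : ∀ {a} → (Σ V λ b → ⌞ b ∈ᵥ c ⌟ × ⌞ ⟨ a , a ⟩ ≅ ⟨ b , b ⟩ ⌟) → ⌞ a ∈ᵥ c ⌟
    forth (b , lift bc , lift e) = lift (∈-respˡ (≅-sym (⟨,⟩-injectiveˡ e)) bc)

  ∈W-values₂ : ∀ {X} → W X → ∀ x y → (λ c → Values X x c ⊎ Values X y c) ∈W W
  ∈W-values₂ wX x y = ∈W-∪ (∈W-values wX x) (∈W-values wX y)

  separable-∈ : ∀ x y {n} (ys : Vec Var (suc n)) {X} → W X → SeparableOn X ys (λ w → ⌞ w x ∈ᵥ w y ⌟)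
  separable-∈ x y ys {X} wX = separable-resp {λ w → ⌞ ⟨ w x , w y ⟩ ∈ᵥ set M ⌟} {ys = ys}
    (λ as al (lift m) → forth (set⁻ M m))
    (λ as al (lift m) → lift (set⁺ M (_ , _ , inj₁ ([≔*]-values ys as x al) , inj₂ ([≔*]-values ys as y al) ,
                                      lift m , lift (≅-refl _))))
    (separable-⟨,⟩∈ x y ys wX (W-set M))
    where
    M = ∈W-memberRel (∈W-values₂ wX x y)
    forth : ∀ {a b} → memberRel (λ c → Values X x c ⊎ Values X y c) ⟨ a , b ⟩ → ⌞ a ∈ᵥ b ⌟
    forth (u , w , _ , _ , lift u∈w , lift e) =
      lift (∈-resp (≅-sym (⟨,⟩-injectiveˡ e)) (≅-sym (⟨,⟩-injectiveʳ e)) u∈w)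

  separable-≅ : ∀ x y {n} (ys : Vec Var (suc n)) {X} → W X → SeparableOn X ys (λ w → ⌞ w x ≅ w y ⌟)
  separable-≅ x y ys {X} wX = separable-resp {λ w → ⌞ ⟨ w x , w y ⟩ ∈ᵥ set Δ ⌟} {ys = ys}
    (λ as al (lift m) → forth (set⁻ Δ m))
    (λ as al (lift e) → lift (set⁺ Δ (_ , lift (set⁺ V₂ (inj₁ ([≔*]-values ys as x al))) ,
                                      lift (⟨,⟩-cong (≅-refl _) (≅-sym e)))))
    (separable-⟨,⟩∈ x y ys wX (W-set Δ))
    where
    V₂ = ∈W-values₂ wX x y
    Δ = ∈W-diagonal (W-set V₂)
    forth : ∀ {a b} → (Σ V λ c → ⌞ c ∈ᵥ set V₂ ⌟ × ⌞ ⟨ a , b ⟩ ≅ ⟨ c , c ⟩ ⌟) → ⌞ a ≅ b ⌟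
    forth (c , _ , lift e) = lift (≅-trans (⟨,⟩-injectiveˡ e) (≅-sym (⟨,⟩-injectiveʳ e)))

  Tuples-∷ʳ⁺ : ∀ {P n} {ys : Vec Var (suc n)} {x X c a} {as : Vec V (suc n)} → Resp P →
               All (members X) as → ⌞ a ∈ᵥ X ⌟ → c ≅ tuple as → P ((v [ ys ≔* as ]) [ x ≔ a ]) →
               Tuples X (ys ∷ʳ x) P ⟨ c , a ⟩
  Tuples-∷ʳ⁺ {ys = ys} {x} {a = a} {as} P-resp al aX c≅as p =
    as ∷ʳ a , All-∷ʳ⁺ al aX , lift (≅-trans (⟨,⟩-cong c≅as (≅-refl a)) (≅-sym (tuple-∷ʳ as a))) ,
    P-resp (≋-sym ([≔*]-∷ʳ v ys as x a)) p

  Tuples-∷ʳ⁻ : ∀ {P n} {ys : Vec Var (suc n)} {x X c a} (as : Vec V (suc n)) → Resp P →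
               Tuples X (ys ∷ʳ x) P ⟨ c , a ⟩ → c ≅ tuple as → P ((v [ ys ≔* as ]) [ x ≔ a ])
  Tuples-∷ʳ⁻ {ys = ys} {x} {a = a} as P-resp (bs , _ , lift e , p) c≅as with initLast bs
  ... | bs₀ , b , refl =
    P-resp (λ z → ≅-trans ([≔*]-∷ʳ v ys bs₀ x b z) (≋-[≔] x (≋-[≔*] ys ≋-refl bs₀≅as) b≅a z)) p
    where
    e' : ⟨ _ , a ⟩ ≅ ⟨ tuple bs₀ , b ⟩
    e' = ≅-trans e (tuple-∷ʳ bs₀ b)
    bs₀≅as : Pointwise _≅_ bs₀ as
    bs₀≅as = tuple-injective bs₀ as (≅-trans (≅-sym (⟨,⟩-injectiveˡ e')) c≅as)
    b≅a : b ≅ a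
    b≅a = ≅-sym (⟨,⟩-injectiveʳ e')

  Tuples-∷ʳ-last : ∀ {P n} {ys : Vec Var (suc n)} {x X c a} → Tuples X (ys ∷ʳ x) P ⟨ c , a ⟩ → a ∈ᵥ X
  Tuples-∷ʳ-last (bs , bl , lift e , _) with initLast bs
  ... | bs₀ , b , refl =
    ∈-respˡ (≅-sym (⟨,⟩-injectiveʳ (≅-trans e (tuple-∷ʳ bs₀ b)))) (lower (proj₂ (All-∷ʳ⁻ bs₀ bl)))

  separable-∃∈ : ∀ {Q n} (ys : Vec Var (suc n)) x {X Y} → W X → W Y → Resp Q → Separable Q →
                 SeparableOn X ys (λ w → Σ V λ a → ⌞ a ∈ᵥ Y ⌟ × Q (w [ x ≔ a ]))
  separable-∃∈ {Q} {n} ys x {X} {Y} wX wY Q-resp Q-sep =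
    separable (∈W-resp (∈W-∩ (∈W-dom (tuples∈W S)) (∈W-power n wX)) forth back)
    where
    XY : (λ z → members X z ⊎ members Y z) ∈W W
    XY = ∈W-∪ (∈W-self wX) (∈W-self wY)
    Q∈Y : Assignment → Set₁
    Q∈Y w = Q w × ⌞ w x ∈ᵥ Y ⌟
    S : SeparableOn (set XY) (ys ∷ʳ x) Q∈Y
    S = separable-∧ (Resp-∈ᶜ x Y) (Q-sep (ys ∷ʳ x) (W-set XY)) (separable-∈ᶜ x (ys ∷ʳ x) (W-set XY) wY)
    forth : ∀ c → _ → Tuples X ys (λ w → Σ V λ a → ⌞ a ∈ᵥ Y ⌟ × Q (w [ x ≔ a ])) c
    forth c ((a , t) , (as , al , lift c≅as)) with Tuples-∷ʳ⁻ {ys = ys} as (Resp-× Q-resp (Resp-∈ᶜ x Y)) t c≅as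
    ... | q , lift x∈Y = as , al , lift c≅as , a , lift (∈-respˡ (≡⇒≅ ([≔]-same (v [ ys ≔* as ]) x a)) x∈Y) , q
    back : ∀ c → Tuples X ys (λ w → Σ V λ a → ⌞ a ∈ᵥ Y ⌟ × Q (w [ x ≔ a ])) c → _
    back c (as , al , lift c≅as , a , lift a∈Y , q) =
      (a , Tuples-∷ʳ⁺ {ys = ys} (Resp-× Q-resp (Resp-∈ᶜ x Y)) (All.map (λ (lift m) → lift (set⁺ XY (inj₁ (lift m)))) al)
                     (lift (set⁺ XY (inj₂ (lift a∈Y)))) c≅as
                     (q , lift (∈-respˡ (≅-sym (≡⇒≅ ([≔]-same (v [ ys ≔* as ]) x a))) a∈Y))) ,
      (as , al , lift c≅as)

-- The simultaneous induction

∈⇒≤sum : ∀ {z} L → z ∈ℓ L → z ≤ sum L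
∈⇒≤sum (y ∷ L) (here refl) = m≤m+n y (sum L)
∈⇒≤sum (y ∷ L) (there m) = ≤-trans (∈⇒≤sum L m) (m≤n+m (sum L) y)

fresh : List Var → Var
fresh L = suc (sum L)

fresh-∉ : ∀ L → ¬ (fresh L ∈ℓ L)
fresh-∉ L m = <-irrefl refl (∈⇒≤sum L m)

fresh-∉ˡ : ∀ L M → ¬ (fresh (L ++ M) ∈ℓ L)
fresh-∉ˡ L M m = fresh-∉ (L ++ M) (∈-++⁺ˡ m)

fresh-∉ʳ : ∀ L M → ¬ (fresh (L ++ M) ∈ℓ M)
fresh-∉ʳ L M m = fresh-∉ (L ++ M) (∈-++⁺ʳ L m)

All-map-fromList : ∀ {P : V → Set₁} (f : Var → V) L → (∀ y → y ∈ℓ L → P (f y)) → All P (map f (fromList L))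
All-map-fromList f [] h = []
All-map-fromList f (y ∷ L) h = h y (here refl) ∷ All-map-fromList f L (λ y m → h y (there m))

∈-++⁺ : ∀ {z : Var} L {M} → z ∈ℓ L ⊎ z ∈ℓ M → z ∈ℓ L ++ M
∈-++⁺ L = [ ∈-++⁺ˡ , ∈-++⁺ʳ L ]′

∉-++ : ∀ {z : Var} L {M} → ¬ (z ∈ℓ L) → ¬ (z ∈ℓ M) → ¬ (z ∈ℓ L ++ M)
∉-++ L z∉L z∉M m = [ z∉L , z∉M ]′ (∈-++⁻ L m)

AgreeOff : List Var → List Var → Assignment → Assignment → Set
AgreeOff L Θ w w' = ∀ z → z ∈ℓ L → ¬ (z ∈ℓ Θ) → w z ≅ w' z

AgreeOff-[≔] : ∀ {L} x (w : Assignment) a → AgreeOff L (x ∷ []) (w [ x ≔ a ]) w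
AgreeOff-[≔] x w a z _ z∉x = ≡⇒≅ ([≔]-other w a (λ z≡x → z∉x (here z≡x)))

module Main (lem : ExcludedMiddle (lsuc lzero)) {W : V → Set₁} (U : IsUniverse W)
            (v : Assignment) (v∈W : ∀ x → W (v x)) where
  open IsUniverse U using (resp) renaming (trans to W-trans)
  open Separation lem U v v∈W
  open Coincidence resp
  open Semantics W

  record Bounded (bounds : V → Set₁) : Set₁ where
    constructor bounded
    field
      bound : V
      W-bound : W bound
      within : bounds bound
  open Bounded

  _∈ₜ_ : Var → Term → Assignment → Set₁
  (x ∈ₜ t) w = ‖ t ‖t w (w x)

  MembershipSeparable : Term → Set₁
  MembershipSeparable t = ∀ x → Separable (x ∈ₜ t)

  ElementsBounded : Term → Set₁
  ElementsBounded t = ∀ {n} (ys : Vec Var (suc n)) {X} → W X → Bounded λ B →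
    ∀ as → All (members X) as → ∀ z → ‖ t ‖t (v [ ys ≔* as ]) z → z ∈ᵥ B

  ValuesBounded : Term → Set₁
  ValuesBounded t = ∀ {n} (ys : Vec Var (suc n)) {X} → W X → Bounded λ B →
    ∀ as → All (members X) as → Σ V λ c → c ∈ᵥ B × (∀ z → ⌞ z ∈ᵥ c ⌟ ⇔ ‖ t ‖t (v [ ys ≔* as ]) z)

  SafeBounded : Formula → List Var → Set₁
  SafeBounded φ Θ = ∀ {n} (ys : Vec Var (suc n)) {X} → W X → Bounded λ B →
    ∀ as → All (members X) as → ∀ w → AgreeOff (FvF φ) Θ w (v [ ys ≔* as ]) →
    ‖ φ ‖f w → ∀ y → y ∈ℓ Θ → w y ∈ᵥ B

  Resp-∈ₜ : ∀ t x → Resp (x ∈ₜ t)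
  Resp-∈ₜ t x w≋w' = ‖‖t-resp t w≋w' (w≋w' x)

  ∈ₜ-fresh⁺ : ∀ t {x} w z → ¬ (x ∈ℓ FvT t) → ‖ t ‖t w z → (x ∈ₜ t) (w [ x ≔ z ])
  ∈ₜ-fresh⁺ t {x} w z x∉t = coincidenceT t (Agree-fresh (FvT t) w z x∉t) (≡⇒≅ (sym ([≔]-same w x z)))

  ∈ₜ-fresh⁻ : ∀ t {x} w z → ¬ (x ∈ℓ FvT t) → (x ∈ₜ t) (w [ x ≔ z ]) → ‖ t ‖t w z
  ∈ₜ-fresh⁻ t {x} w z x∉t = coincidenceT t (Agree-sym (Agree-fresh (FvT t) w z x∉t)) (≡⇒≅ ([≔]-same w x z))

  separable-∈var : ∀ y → MembershipSeparable (var y)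
  separable-∈var y x ys wX = separable-∈ x y ys wX

  elements-bounded-var : ∀ y → ElementsBounded (var y)
  elements-bounded-var y ys {X} wX = bounded (set S) (W-set S)
    λ as al z (lift m) → set⁺ S (_ , [≔*]-values ys as y al , lift m)
    where S = ∈W-⋃ (∈W-values wX y)

  values-bounded-var : ∀ y → ValuesBounded (var y)
  values-bounded-var y ys {X} wX = bounded (set S) (W-set S)
    λ as al → (v [ ys ≔* as ]) y , set⁺ S ([≔*]-values ys as y al) , λ z → mk⇔ (λ m → m) (λ m → m)
    where S = ∈W-values wX y

  Distinguishes : Var → Term → Term → Assignment → Set₁
  Distinguishes x t s w = ((x ∈ₜ t) w × ¬ (x ∈ₜ s) w) ⊎ ((x ∈ₜ s) w × ¬ (x ∈ₜ t) w)

  Resp-Distinguishes : ∀ x t s → Resp (Distinguishes x t s)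
  Resp-Distinguishes x t s = Resp-⊎ (Resp-× (Resp-∈ₜ t x) (Resp-¬ (Resp-∈ₜ s x)))
                                    (Resp-× (Resp-∈ₜ s x) (Resp-¬ (Resp-∈ₜ t x)))

  separable-Distinguishes : ∀ x t s → MembershipSeparable t → MembershipSeparable s →
                            Separable (Distinguishes x t s)
  separable-Distinguishes x t s t-sep s-sep ys wX = separable-⊎
    (separable-∧ (Resp-¬ (Resp-∈ₜ s x)) (t-sep x ys wX) (separable-¬ wX (Resp-∈ₜ s x) (s-sep x ys wX)))
    (separable-∧ (Resp-¬ (Resp-∈ₜ t x)) (s-sep x ys wX) (separable-¬ wX (Resp-∈ₜ t x) (t-sep x ys wX)))

  separable-≐ : ∀ t s → MembershipSeparable t → ElementsBounded t →
                MembershipSeparable s → ElementsBounded s → Separable ‖ t ≐ s ‖f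
  separable-≐ t s t-sep t-bd s-sep s-bd ys {X} wX =
    separable-resp {λ w → ¬ (Σ V λ a → ⌞ a ∈ᵥ set Z ⌟ × Distinguishes x t s (w [ x ≔ a ]))} {ys = ys}
      (λ as al → ¬distinguished⇒≐ (v [ ys ≔* as ]) (within Bt as al) (within Bs as al))
      (λ as al → ≐⇒¬distinguished (v [ ys ≔* as ]))
      (separable-¬ wX (Resp-∃∈ x (set Z) (Resp-Distinguishes x t s))
        (separable-∃∈ ys x wX (W-set Z) (Resp-Distinguishes x t s) (separable-Distinguishes x t s t-sep s-sep)))
    where
    x = fresh (FvT t ++ FvT s)
    x∉t = fresh-∉ˡ (FvT t) (FvT s)
    x∉s = fresh-∉ʳ (FvT t) (FvT s)
    Bt = t-bd ys wX
    Bs = s-bd ys wX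
    Z : (λ z → members (bound Bt) z ⊎ members (bound Bs) z) ∈W W
    Z = ∈W-∪ (∈W-self (W-bound Bt)) (∈W-self (W-bound Bs))
    ¬distinguished⇒≐ : ∀ w → (∀ z → ‖ t ‖t w z → z ∈ᵥ bound Bt) → (∀ z → ‖ s ‖t w z → z ∈ᵥ bound Bs) →
      ¬ (Σ V λ a → ⌞ a ∈ᵥ set Z ⌟ × Distinguishes x t s (w [ x ≔ a ])) → ‖ t ≐ s ‖f w
    ¬distinguished⇒≐ w t⊆Bt s⊆Bs ¬d z = mk⇔ t⇒s s⇒t
      where
      t⇒s : ‖ t ‖t w z → ‖ s ‖t w z
      t⇒s z∈t with lem {‖ s ‖t w z}
      ... | yes z∈s = z∈s
      ... | no z∉s = ⊥-elim (¬d (z , lift (set⁺ Z (inj₁ (lift (t⊆Bt z z∈t)))) ,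
                                inj₁ (∈ₜ-fresh⁺ t w z x∉t z∈t , λ m → z∉s (∈ₜ-fresh⁻ s w z x∉s m))))
      s⇒t : ‖ s ‖t w z → ‖ t ‖t w z
      s⇒t z∈s with lem {‖ t ‖t w z}
      ... | yes z∈t = z∈t
      ... | no z∉t = ⊥-elim (¬d (z , lift (set⁺ Z (inj₂ (lift (s⊆Bs z z∈s)))) ,
                                inj₂ (∈ₜ-fresh⁺ s w z x∉s z∈s , λ m → z∉t (∈ₜ-fresh⁻ t w z x∉t m))))
    ≐⇒¬distinguished : ∀ w → ‖ t ≐ s ‖f w → ¬ (Σ V λ a → ⌞ a ∈ᵥ set Z ⌟ × Distinguishes x t s (w [ x ≔ a ]))
    ≐⇒¬distinguished w t≐s (a , _ , inj₁ (a∈t , a∉s)) =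
      a∉s (∈ₜ-fresh⁺ s w a x∉s (to (t≐s a) (∈ₜ-fresh⁻ t w a x∉t a∈t)))
    ≐⇒¬distinguished w t≐s (a , _ , inj₂ (a∈s , a∉t)) =
      a∉t (∈ₜ-fresh⁺ t w a x∉t (from (t≐s a) (∈ₜ-fresh⁻ s w a x∉s a∈s)))

  separable-∈' : ∀ t s → ValuesBounded t → MembershipSeparable t → ElementsBounded t →
                 MembershipSeparable s → Separable ‖ t ∈' s ‖f
  separable-∈' t s t-val t-sep t-bd s-sep ys {X} wX =
    separable-resp {λ w → Σ V λ a → ⌞ a ∈ᵥ bound Vt ⌟ × Named (w [ x ≔ a ])} {ys = ys}
      (λ as al → named⇒∈ (v [ ys ≔* as ]))
      (λ as al → ∈⇒named (v [ ys ≔* as ]) (within Vt as al))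
      (separable-∃∈ ys x wX (W-bound Vt) Resp-Named separable-Named)
    where
    x = fresh (FvT t ++ FvT s)
    x∉t = fresh-∉ˡ (FvT t) (FvT s)
    x∉s = fresh-∉ʳ (FvT t) (FvT s)
    Vt = t-val ys wX
    Named : Assignment → Set₁
    Named w = ‖ var x ≐ t ‖f w × (x ∈ₜ s) w
    Resp-Named : Resp Named
    Resp-Named = Resp-× (‖‖f-resp (var x ≐ t)) (Resp-∈ₜ s x)
    separable-Named : Separable Named
    separable-Named ys' wZ = separable-∧ (Resp-∈ₜ s x)
      (separable-≐ (var x) t (separable-∈var x) (elements-bounded-var x) t-sep t-bd ys' wZ) (s-sep x ys' wZ)
    x≐t⇔ : ∀ w a → ‖ var x ≐ t ‖f (w [ x ≔ a ]) ⇔ (∀ z → ⌞ z ∈ᵥ a ⌟ ⇔ ‖ t ‖t w z)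
    x≐t⇔ w a = mk⇔
      (λ eq z → mk⇔ (λ (lift m) → coincidenceT t (Agree-sym (Agree-fresh (FvT t) w a x∉t)) (≅-refl z)
                                      (to (eq z) (lift (∈-respʳ (≅-sym x↦a) m))))
                    (λ p → lift (∈-respʳ x↦a (lower (from (eq z)
                                      (coincidenceT t (Agree-fresh (FvT t) w a x∉t) (≅-refl z) p))))))
      (λ h z → mk⇔ (λ (lift m) → coincidenceT t (Agree-fresh (FvT t) w a x∉t) (≅-refl z) (to (h z) (lift (∈-respʳ x↦a m))))
                   (λ p → lift (∈-respʳ (≅-sym x↦a) (lower (from (h z)
                                      (coincidenceT t (Agree-sym (Agree-fresh (FvT t) w a x∉t)) (≅-refl z) p))))))
      where
      x↦a : (w [ x ≔ a ]) x ≅ a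
      x↦a = ≡⇒≅ ([≔]-same w x a)
    named⇒∈ : ∀ w → (Σ V λ a → ⌞ a ∈ᵥ bound Vt ⌟ × Named (w [ x ≔ a ])) → ‖ t ∈' s ‖f w
    named⇒∈ w (a , _ , x≐t , x∈s) = a , to (x≐t⇔ w a) x≐t , ∈ₜ-fresh⁻ s w a x∉s x∈s
    ∈⇒named : ∀ w → (Σ V λ c → c ∈ᵥ bound Vt × (∀ z → ⌞ z ∈ᵥ c ⌟ ⇔ ‖ t ‖t w z)) →
              ‖ t ∈' s ‖f w → Σ V λ a → ⌞ a ∈ᵥ bound Vt ⌟ × Named (w [ x ≔ a ])
    ∈⇒named w (c , c∈Vt , c≐t) (a , a≐t , a∈s) =
      c , lift c∈Vt , from (x≐t⇔ w c) c≐t , ∈ₜ-fresh⁺ s w c x∉s (‖‖t-resp s ≋-refl a≅c a∈s)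
      where
      a≅c : a ≅ c
      a≅c = ≅-ext (λ z m → lower (from (c≐t z) (to (a≐t z) (lift m))))
                  (λ z m → lower (from (a≐t z) (to (c≐t z) (lift m))))

  -- The variables Θ of φ, once bounded, are treated as further parameters of ψ.
  safe-bounded-sequential : ∀ {φ ψ Θ Φ} → SafeBounded φ Θ → SafeBounded ψ Φ → Disjoint Φ (FvF φ) →
    ∀ {n} (ys : Vec Var (suc n)) {X} → W X → Bounded λ B →
    ∀ as → All (members X) as → ∀ w →
    (∀ z → z ∈ℓ FvF φ ⊎ z ∈ℓ FvF ψ → ¬ (z ∈ℓ Θ) → ¬ (z ∈ℓ Φ) → w z ≅ (v [ ys ≔* as ]) z) →
    ‖ φ ‖f w → ‖ ψ ‖f w → ∀ y → y ∈ℓ Θ ⊎ y ∈ℓ Φ → w y ∈ᵥ B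
  safe-bounded-sequential {φ} {ψ} {Θ} {Φ} φ-bd ψ-bd Φ#φ ys {X} wX = bounded (set B) (W-set B) bounds
    where
    B₁ = φ-bd ys wX
    X' : (λ z → members X z ⊎ members (bound B₁) z) ∈W W
    X' = ∈W-∪ (∈W-self wX) (∈W-self (W-bound B₁))
    ys' = ys ++ᵛ fromList Θ
    B₂ = ψ-bd ys' (W-set X')
    B : (λ z → members (bound B₁) z ⊎ members (bound B₂) z) ∈W W
    B = ∈W-∪ (∈W-self (W-bound B₁)) (∈W-self (W-bound B₂))
    bounds : ∀ as → All (members X) as → ∀ w → _ → ‖ φ ‖f w → ‖ ψ ‖f w →
             ∀ y → y ∈ℓ Θ ⊎ y ∈ℓ Φ → w y ∈ᵥ set B
    bounds as al w agree p q y y∈ = [ (λ y∈Θ → set⁺ B (inj₁ (lift (Θ⊆B₁ y y∈Θ))))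
                                    , (λ y∈Φ → set⁺ B (inj₂ (lift (within B₂ as' al' w agree' q y y∈Φ)))) ]′ y∈
      where
      Θ⊆B₁ : ∀ y → y ∈ℓ Θ → w y ∈ᵥ bound B₁
      Θ⊆B₁ = within B₁ as al w (λ z z∈φ z∉Θ → agree z (inj₁ z∈φ) z∉Θ (λ z∈Φ → Φ#φ z z∈Φ z∈φ)) p
      as' = as ++ᵛ map w (fromList Θ)
      al' : All (members (set X')) as'
      al' = ++⁺ (All.map (λ (lift m) → lift (set⁺ X' (inj₁ (lift m)))) al)
                (All-map-fromList w Θ (λ y y∈Θ → lift (set⁺ X' (inj₂ (lift (Θ⊆B₁ y y∈Θ))))))
      split : ∀ z → (v [ ys' ≔* as' ]) z ≡ ((v [ ys ≔* as ]) [ fromList Θ ≔* map w (fromList Θ) ]) z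
      split = [≔*]-++ v ys as (fromList Θ) (map w (fromList Θ))
      agree' : AgreeOff (FvF ψ) Φ w (v [ ys' ≔* as' ])
      agree' z z∈ψ z∉Φ with z ∈? Θ
      ... | yes z∈Θ = ≅-sym (≡⇒≅ (trans (split z)
                        ([≔*]-map (v [ ys ≔* as ]) w (fromList Θ) (subst (z ∈ℓ_) (sym (toList∘fromList Θ)) z∈Θ))))
      ... | no z∉Θ = ≅-trans (agree z (inj₂ z∈ψ) z∉Θ z∉Φ) (≅-sym (≡⇒≅ (trans (split z)
                        ([≔*]-outside (v [ ys ≔* as ]) (fromList Θ) (map w (fromList Θ))
                                      (λ m → z∉Θ (subst (z ∈ℓ_) (toList∘fromList Θ) m))))))

  separable-∈abs : ∀ y φ (p : φ ≻ (y ∷ [])) → Separable ‖ φ ‖f → MembershipSeparable (abs y φ p)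
  separable-∈abs y φ p φ-sep x ys {X} wX with x ≟ y
  ... | yes refl = separable-resp {‖ φ ‖f} {ys = ys}
    (λ as al q → W-[≔*] ys as wX al x , ‖‖f-resp φ (≋-sym (≡⇒≋ ([≔]-self (v [ ys ≔* as ]) x))) q)
    (λ as al (_ , q) → ‖‖f-resp φ (≡⇒≋ ([≔]-self (v [ ys ≔* as ]) x)) q)
    (φ-sep ys wX)
  ... | no x≢y = separable-resp {λ w → Σ V λ a → ⌞ a ∈ᵥ set Vx ⌟ × Named (w [ y ≔ a ])} {ys = ys}
    (λ as al → named⇒∈ (v [ ys ≔* as ]) (W-[≔*] ys as wX al x))
    (λ as al → ∈⇒named (v [ ys ≔* as ]) ([≔*]-values ys as x al))
    (separable-∃∈ ys y wX (W-set Vx) Resp-Named separable-Named)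
    where
    Vx = ∈W-values wX x
    Named : Assignment → Set₁
    Named w = ⌞ w y ≅ w x ⌟ × ‖ φ ‖f w
    Resp-Named : Resp Named
    Resp-Named = Resp-× (λ w≋w' (lift e) → lift (≅-trans (≅-sym (w≋w' y)) (≅-trans e (w≋w' x)))) (‖‖f-resp φ)
    separable-Named : Separable Named
    separable-Named ys' wZ = separable-∧ (‖‖f-resp φ) (separable-≅ y x ys' wZ) (φ-sep ys' wZ)
    named⇒∈ : ∀ w → W (w x) → (Σ V λ a → ⌞ a ∈ᵥ set Vx ⌟ × Named (w [ y ≔ a ])) → (x ∈ₜ abs y φ p) w
    named⇒∈ w wx (a , _ , lift a≅x , q) = wx , ‖‖f-resp φ (≋-[≔] y ≋-refl a≅wx) q
      where
      a≅wx : a ≅ w x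
      a≅wx = ≅-trans (≡⇒≅ (sym ([≔]-same w y a))) (≅-trans a≅x (≡⇒≅ ([≔]-other w a x≢y)))
    ∈⇒named : ∀ w → Values X x (w x) → (x ∈ₜ abs y φ p) w → Σ V λ a → ⌞ a ∈ᵥ set Vx ⌟ × Named (w [ y ≔ a ])
    ∈⇒named w wx∈Vx (_ , q) =
      w x , lift (set⁺ Vx wx∈Vx) , lift (≅-trans (≡⇒≅ ([≔]-same w y (w x))) (≡⇒≅ (sym ([≔]-other w (w x) x≢y)))) , q

  elements-bounded-abs : ∀ x φ (p : φ ≻ (x ∷ [])) → SafeBounded φ (x ∷ []) → ElementsBounded (abs x φ p)
  elements-bounded-abs x φ p φ-bd ys wX = bounded (bound B) (W-bound B) λ as al z (_ , q) →
    ∈-respˡ (≡⇒≅ ([≔]-same (v [ ys ≔* as ]) x z))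
            (within B as al _ (AgreeOff-[≔] x (v [ ys ≔* as ]) z) q x (here refl))
    where
    B = φ-bd ys wX

  values-bounded-abs : ∀ x φ (p : φ ≻ (x ∷ [])) → Separable ‖ φ ‖f → SafeBounded φ (x ∷ []) →
                       ValuesBounded (abs x φ p)
  values-bounded-abs x φ p φ-sep φ-bd {n} ys {X} wX =
    bounded (set Img) (W-set Img) λ as al → section as , section∈Img as al , section≐abs as al
    where
    B = φ-bd ys wX
    XB : (λ z → members X z ⊎ members (bound B) z) ∈W W
    XB = ∈W-∪ (∈W-self wX) (∈W-self (W-bound B))
    S = tuples∈W (φ-sep (ys ∷ʳ x) (W-set XB))
    Xⁿ = ∈W-power n wX
    -- F5 (S, {{t} : t ∈ Xⁿ}) = {{z : ⟨t, z⟩ ∈ S} : t ∈ Xⁿ}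
    Img = IsUniverse.cl5 U (W-set S) (W-set (∈W-singletons (W-set Xⁿ)))
    In-section : Vec V (suc n) → V → Set
    In-section as z = ⟨ tuple as , z ⟩ ∈ᵥ set S
    In-section-resp : ∀ as {a b} → a ≅ b → In-section as a → In-section as b
    In-section-resp as e = ∈-respˡ (⟨,⟩-cong (≅-refl _) e)
    section : Vec V (suc n) → V
    section as = sep (set XB) (In-section as)
    last∈XB : ∀ {c z} → Tuples (set XB) (ys ∷ʳ x) ‖ φ ‖f ⟨ c , z ⟩ → z ∈ᵥ set XB
    last∈XB = Tuples-∷ʳ-last {‖ φ ‖f} {ys = ys} {x}
    ∈-section⁺ : ∀ as {z} → In-section as z → z ∈ᵥ section as
    ∈-section⁺ as m = ∈-sep⁺ (In-section as) (In-section-resp as) (set XB) (last∈XB (set⁻ S m)) m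
    ∈-section⁻ : ∀ as {z} → z ∈ᵥ section as → In-section as z
    ∈-section⁻ as m = proj₂ (∈-sep⁻ (In-section as) (In-section-resp as) (set XB) m)
    section∈Img : ∀ as → All (members X) as → section as ∈ᵥ set Img
    section∈Img as al = set⁺ Img (upair (tuple as) (tuple as) ,
      lift (set⁺ (∈W-singletons (W-set Xⁿ)) (tuple as , lift (set⁺ Xⁿ (as , al , lift (≅-refl _))) , lift (≅-refl _))) ,
      λ z → mk⇔ (λ (lift m) → tuple as , lift (∈-upair⁺ˡ (≅-refl _)) , lift (∈-section⁻ as m))
                (λ (u , lift u∈t , lift m) →
                   lift (∈-section⁺ as (∈-respˡ (⟨,⟩-cong (∈-singleton⁻ u∈t) (≅-refl z)) m))))
    section≐abs : ∀ as → All (members X) as →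
                  ∀ z → ⌞ z ∈ᵥ section as ⌟ ⇔ ‖ abs x φ p ‖t (v [ ys ≔* as ]) z
    section≐abs as al z = mk⇔
      (λ (lift m) → let z∈S = set⁻ S (∈-section⁻ as m) in
                    W-trans (W-set XB) (last∈XB z∈S) , Tuples-∷ʳ⁻ {ys = ys} as (‖‖f-resp φ) z∈S (≅-refl _))
      (λ (_ , q) → lift (∈-section⁺ as (set⁺ S (Tuples-∷ʳ⁺ {ys = ys} (‖‖f-resp φ)
         (All.map (λ (lift m) → lift (set⁺ XB (inj₁ (lift m)))) al)
         (lift (set⁺ XB (inj₂ (lift (z∈B q))))) (≅-refl _) q))))
      where
      z∈B : ‖ φ ‖f ((v [ ys ≔* as ]) [ x ≔ z ]) → z ∈ᵥ bound B
      z∈B q = ∈-respˡ (≡⇒≅ ([≔]-same (v [ ys ≔* as ]) x z))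
                      (within B as al _ (AgreeOff-[≔] x (v [ ys ≔* as ]) z) q x (here refl))

  separable-∃' : ∀ {φ Θ} y → y ∈ℓ Θ → Separable ‖ φ ‖f → SafeBounded φ Θ → Separable ‖ ∃' y φ ‖f
  separable-∃' {φ} {Θ} y y∈Θ φ-sep φ-bd ys {X} wX =
    separable-resp {λ w → Σ V λ a → ⌞ a ∈ᵥ bound B ⌟ × ‖ φ ‖f (w [ y ≔ a ])} {ys = ys}
      (λ as al (a , lift a∈B , q) → a , W-trans (W-bound B) a∈B , q)
      (λ as al (a , _ , q) → a , lift (witness∈B as al a q) , q)
      (separable-∃∈ ys y wX (W-bound B) (‖‖f-resp φ) φ-sep)
    where
    B = φ-bd ys wX
    witness∈B : ∀ as → All (members X) as → ∀ a → ‖ φ ‖f ((v [ ys ≔* as ]) [ y ≔ a ]) → a ∈ᵥ bound B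
    witness∈B as al a q = ∈-respˡ (≡⇒≅ ([≔]-same (v [ ys ≔* as ]) y a))
                                  (within B as al ((v [ ys ≔* as ]) [ y ≔ a ]) agree q y y∈Θ)
      where
      agree : AgreeOff (FvF φ) Θ ((v [ ys ≔* as ]) [ y ≔ a ]) (v [ ys ≔* as ])
      agree z _ z∉Θ = ≡⇒≅ ([≔]-other (v [ ys ≔* as ]) a (λ z≡y → z∉Θ (subst (_∈ℓ Θ) (sym z≡y) y∈Θ)))

  safe-bounded-[] : ∀ φ → SafeBounded φ []
  safe-bounded-[] φ ys wX = bounded _ wX λ _ _ _ _ _ _ ()

  safe-bounded-≠ : ∀ x → SafeBounded (¬' (var x ≐ var x)) (x ∷ [])
  safe-bounded-≠ x ys wX = bounded _ wX λ _ _ _ _ x≠x → ⊥-elim (x≠x (λ z → mk⇔ (λ m → m) (λ m → m)))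

  value-bounded : ∀ t → ValuesBounded t → ∀ {n} (ys : Vec Var (suc n)) {X} → W X →
    Bounded λ B → ∀ as → All (members X) as → ∀ w → Agree (FvT t) w (v [ ys ≔* as ]) →
    ∀ a → (∀ z → ⌞ z ∈ᵥ a ⌟ ⇔ ‖ t ‖t w z) → a ∈ᵥ B
  value-bounded t t-val ys wX = bounded (bound Vt) (W-bound Vt) λ as al w agree a a≐t →
    let (c , c∈B , c≐t) = within Vt as al in
    ∈-respˡ (≅-ext (λ z m → lower (from (a≐t z) (coincidenceT t (Agree-sym agree) (≅-refl z) (to (c≐t z) (lift m)))))
                   (λ z m → lower (from (c≐t z) (coincidenceT t agree (≅-refl z) (to (a≐t z) (lift m))))))
            c∈B
    where Vt = t-val ys wX

  safe-bounded-≐ˡ : ∀ x t → ¬ (x ∈ℓ FvT t) → ValuesBounded t → SafeBounded (var x ≐ t) (x ∷ [])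
  safe-bounded-≐ˡ x t x∉t t-val ys wX = bounded (bound B) (W-bound B) λ {
    as al w agree x≐t _ (here refl) →
      within B as al w (λ z z∈t → agree z (there z∈t) (λ { (here refl) → x∉t z∈t })) (w x) x≐t }
    where B = value-bounded t t-val ys wX

  safe-bounded-≐ʳ : ∀ x t → ¬ (x ∈ℓ FvT t) → ValuesBounded t → SafeBounded (t ≐ var x) (x ∷ [])
  safe-bounded-≐ʳ x t x∉t t-val ys wX = bounded (bound B) (W-bound B) λ {
    as al w agree t≐x _ (here refl) →
      within B as al w (λ z z∈t → agree z (∈-++⁺ˡ z∈t) (λ { (here refl) → x∉t z∈t }))
                       (w x) (λ z → mk⇔ (from (t≐x z)) (to (t≐x z))) }
    where B = value-bounded t t-val ys wX

  safe-bounded-∈ : ∀ x t → ¬ (x ∈ℓ FvT t) → ElementsBounded t → SafeBounded (var x ∈' t) (x ∷ [])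
  safe-bounded-∈ x t x∉t t-bd ys {X} wX = bounded (bound Bt) (W-bound Bt) bounds
    where
    Bt = t-bd ys wX
    bounds : ∀ as → All (members X) as → ∀ w → AgreeOff (FvF (var x ∈' t)) (x ∷ []) w (v [ ys ≔* as ]) →
             ‖ var x ∈' t ‖f w → ∀ y → y ∈ℓ x ∷ [] → w y ∈ᵥ bound Bt
    bounds as al w agree (a , a≐x , a∈t) _ (here refl) =
      ∈-respˡ (≅-ext (λ z m → lower (to (a≐x z) (lift m))) (λ z m → lower (from (a≐x z) (lift m))))
              (within Bt as al a (coincidenceT t (λ z z∈t → agree z (there z∈t) (λ { (here refl) → x∉t z∈t }))
                                                 (≅-refl a) a∈t))

  safe-bounded-∧ : ∀ {φ ψ Θ Φ} → SafeBounded φ Θ → SafeBounded ψ Φ →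
                   Disjoint Φ (FvF φ) ⊎ Disjoint Θ (FvF ψ) → SafeBounded (φ ∧' ψ) (Θ ++ Φ)
  safe-bounded-∧ {φ} {ψ} {Θ} {Φ} φ-bd ψ-bd (inj₁ Φ#φ) ys wX = bounded (bound B) (W-bound B)
    λ as al w agree (p , q) y y∈ →
      within B as al w (λ z z∈ z∉Θ z∉Φ → agree z (∈-++⁺ (FvF φ) z∈) (∉-++ Θ z∉Θ z∉Φ))
             p q y (∈-++⁻ Θ y∈)
    where B = safe-bounded-sequential φ-bd ψ-bd Φ#φ ys wX
  safe-bounded-∧ {φ} {ψ} {Θ} {Φ} φ-bd ψ-bd (inj₂ Θ#ψ) ys wX = bounded (bound B) (W-bound B)
    λ as al w agree (p , q) y y∈ →
      within B as al w (λ z z∈ z∉Φ z∉Θ → agree z (∈-++⁺ (FvF φ) (swap z∈)) (∉-++ Θ z∉Θ z∉Φ))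
             q p y (swap (∈-++⁻ Θ y∈))
    where B = safe-bounded-sequential ψ-bd φ-bd Θ#ψ ys wX

  safe-bounded-∨ : ∀ {φ ψ Θ} → SafeBounded φ Θ → SafeBounded ψ Θ → SafeBounded (φ ∨' ψ) Θ
  safe-bounded-∨ {φ} {ψ} {Θ} φ-bd ψ-bd ys {X} wX = bounded (set B) (W-set B) bounds
    where
    B₁ = φ-bd ys wX
    B₂ = ψ-bd ys wX
    B : (λ z → members (bound B₁) z ⊎ members (bound B₂) z) ∈W W
    B = ∈W-∪ (∈W-self (W-bound B₁)) (∈W-self (W-bound B₂))
    bounds : ∀ as → All (members X) as → ∀ w → AgreeOff (FvF φ ++ FvF ψ) Θ w (v [ ys ≔* as ]) →
             ‖ φ ∨' ψ ‖f w → ∀ y → y ∈ℓ Θ → w y ∈ᵥ set B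
    bounds as al w agree (inj₁ p) y y∈Θ =
      set⁺ B (inj₁ (lift (within B₁ as al w (λ z z∈φ → agree z (∈-++⁺ˡ z∈φ)) p y y∈Θ)))
    bounds as al w agree (inj₂ q) y y∈Θ =
      set⁺ B (inj₂ (lift (within B₂ as al w (λ z z∈ψ → agree z (∈-++⁺ʳ (FvF φ) z∈ψ)) q y y∈Θ)))

  safe-bounded-∃ : ∀ {φ Θ y} → y ∈ℓ Θ → SafeBounded φ Θ → SafeBounded (∃' y φ) (rm y Θ)
  safe-bounded-∃ {φ} {Θ} {y} y∈Θ φ-bd ys wX = bounded (bound B) (W-bound B) λ as al w agree (b , _ , p) z z∈ →
    let (z∈Θ , z≢y) = ∈-rm⁻ Θ z∈ in
    ∈-respˡ (≡⇒≅ ([≔]-other w b z≢y)) (within B as al (w [ y ≔ b ]) (agree' as w agree b) p z z∈Θ)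
    where
    B = φ-bd ys wX
    agree' : ∀ as w → AgreeOff (rm y (FvF φ)) (rm y Θ) w (v [ ys ≔* as ]) →
             ∀ b → AgreeOff (FvF φ) Θ (w [ y ≔ b ]) (v [ ys ≔* as ])
    agree' as w agree b z z∈φ z∉Θ =
      ≅-trans (≡⇒≅ ([≔]-other w b z≢y)) (agree z (∈-rm⁺ (FvF φ) z∈φ z≢y) (λ m → z∉Θ (proj₁ (∈-rm⁻ Θ m))))
      where
      z≢y : z ≢ y
      z≢y z≡y = z∉Θ (subst (_∈ℓ Θ) (sym z≡y) y∈Θ)

  safe-bounded-≈ : ∀ {φ Θ Θ'} → SafeBounded φ Θ → (∀ z → z ∈ℓ Θ ⇔ z ∈ℓ Θ') → SafeBounded φ Θ'
  safe-bounded-≈ φ-bd Θ≈Θ' ys wX = bounded (bound B) (W-bound B) λ as al w agree p y y∈ →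
    within B as al w (λ z z∈φ z∉Θ → agree z z∈φ (λ m → z∉Θ (from (Θ≈Θ' z) m))) p y (from (Θ≈Θ' y) y∈)
    where B = φ-bd ys wX

  separable-‖‖f : ∀ {φ Θ} → φ ≻ Θ → Separable ‖ φ ‖f
  safe-bounded : ∀ {φ Θ} → φ ≻ Θ → SafeBounded φ Θ
  separable-∈ₜ : ∀ t → MembershipSeparable t
  elements-bounded : ∀ t → ElementsBounded t
  values-bounded : ∀ t → ValuesBounded t

  separable-‖‖f (s-atEq t s) =
    separable-≐ t s (separable-∈ₜ t) (elements-bounded t) (separable-∈ₜ s) (elements-bounded s)
  separable-‖‖f (s-atIn t s) =
    separable-∈' t s (values-bounded t) (separable-∈ₜ t) (elements-bounded t) (separable-∈ₜ s)
  separable-‖‖f (s-neq x) ys wX = separable-¬ wX (‖‖f-resp (var x ≐ var x))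
    (separable-≐ (var x) (var x) (separable-∈var x) (elements-bounded-var x)
                                 (separable-∈var x) (elements-bounded-var x) ys wX)
  separable-‖‖f (s-in x t _) =
    separable-∈' (var x) t (values-bounded-var x) (separable-∈var x) (elements-bounded-var x) (separable-∈ₜ t)
  separable-‖‖f (s-eqL x t _) =
    separable-≐ (var x) t (separable-∈var x) (elements-bounded-var x) (separable-∈ₜ t) (elements-bounded t)
  separable-‖‖f (s-eqR x t _) =
    separable-≐ t (var x) (separable-∈ₜ t) (elements-bounded t) (separable-∈var x) (elements-bounded-var x)
  separable-‖‖f (s-neg {φ} d) ys wX = separable-¬ wX (‖‖f-resp φ) (separable-‖‖f d ys wX)
  separable-‖‖f (s-or d e) ys wX = separable-⊎ (separable-‖‖f d ys wX) (separable-‖‖f e ys wX)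
  separable-‖‖f (s-and {ψ = ψ} d e _) ys wX =
    separable-∧ (‖‖f-resp ψ) (separable-‖‖f d ys wX) (separable-‖‖f e ys wX)
  separable-‖‖f (s-ex {y = y} d y∈Θ) = separable-∃' y y∈Θ (separable-‖‖f d) (safe-bounded d)
  separable-‖‖f (s-set d _) = separable-‖‖f d

  safe-bounded (s-atEq t s) = safe-bounded-[] (t ≐ s)
  safe-bounded (s-atIn t s) = safe-bounded-[] (t ∈' s)
  safe-bounded (s-neq x) = safe-bounded-≠ x
  safe-bounded (s-in x t x∉t) = safe-bounded-∈ x t x∉t (elements-bounded t)
  safe-bounded (s-eqL x t x∉t) = safe-bounded-≐ˡ x t x∉t (values-bounded t)
  safe-bounded (s-eqR x t x∉t) = safe-bounded-≐ʳ x t x∉t (values-bounded t)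
  safe-bounded (s-neg {φ} _) = safe-bounded-[] (¬' φ)
  safe-bounded (s-or d e) = safe-bounded-∨ (safe-bounded d) (safe-bounded e)
  safe-bounded (s-and d e disjoint) = safe-bounded-∧ (safe-bounded d) (safe-bounded e) disjoint
  safe-bounded (s-ex d y∈Θ) = safe-bounded-∃ y∈Θ (safe-bounded d)
  safe-bounded (s-set d Θ≈Θ') = safe-bounded-≈ (safe-bounded d) Θ≈Θ'

  separable-∈ₜ (var y) = separable-∈var y
  separable-∈ₜ HF x ys wX = separable-resp {λ w → ⌞ w x ∈ᵥ set H ⌟} {ys = ys}
    (λ as al (lift m) → set⁻ H m) (λ as al p → lift (set⁺ H p)) (separable-∈ᶜ x ys wX (W-set H))
    where H = IsUniverse.cl9 U wX
  separable-∈ₜ (abs y φ p) = separable-∈abs y φ p (separable-‖‖f p)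

  elements-bounded (var y) = elements-bounded-var y
  elements-bounded HF ys wX = bounded (set H) (W-set H) λ as al z p → set⁺ H p
    where H = IsUniverse.cl9 U wX
  elements-bounded (abs x φ p) = elements-bounded-abs x φ p (safe-bounded p)

  values-bounded (var y) = values-bounded-var y
  values-bounded HF ys wX =
    bounded (set S) (W-set S) λ as al → set H , set⁺ S (lift (≅-refl _)) , proj₂ (proj₂ H)
    where
    H = IsUniverse.cl9 U wX
    S = ∈W-singleton (W-set H)
  values-bounded (abs x φ p) = values-bounded-abs x φ p (separable-‖‖f p) (safe-bounded p)

module _ (lem : ExcludedMiddle (lsuc lzero)) (W : V → Set₁) (U : IsUniverse W)
         (v : Assignment) (v∈W : ∀ x → W (v x)) where
  open IsUniverse U using () renaming (trans to W-trans)
  open Main lem U v v∈W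
  open Separation lem U v v∈W using (tuples∈W; ∈W-resp; ∈W-singleton; set; W-set; set⁺)
  open Bounded
  open Coincidence (IsUniverse.resp U)
  open Semantics W

  -- The bounds are stated for at least one parameter; the dummy parameter 0,
  -- given its own value from the set {v 0}, leaves v unchanged.
  private
    S₀ : singleton (v 0) ∈W W
    S₀ = ∈W-singleton (v∈W 0)
    v0∈S₀ : All (members (set S₀)) (v 0 ∷ [])
    v0∈S₀ = lift (set⁺ S₀ (lift (≅-refl (v 0)))) ∷ []
    v≋v₀ : v ≋ (v [ 0 ∷ [] ≔* v 0 ∷ [] ])
    v≋v₀ = ≋-sym (≡⇒≋ ([≔]-self v 0))

  term-values∈W : (t : Term) → ‖ t ‖t v ∈W W
  term-values∈W t = c , W-trans (W-bound B) c∈B ,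
    λ z → mk⇔ (λ m → ‖‖t-resp t (≋-sym v≋v₀) (≅-refl z) (to (c≐t z) m))
              (λ p → from (c≐t z) (‖‖t-resp t v≋v₀ (≅-refl z) p))
    where
    B = values-bounded t (0 ∷ []) (W-set S₀)
    c = proj₁ (within B (v 0 ∷ []) v0∈S₀)
    c∈B = proj₁ (proj₂ (within B (v 0 ∷ []) v0∈S₀))
    c≐t = proj₂ (proj₂ (within B (v 0 ∷ []) v0∈S₀))

  safe-tuples∈W : (φ : Formula) (n : ℕ) (ys : Vec Var (suc n)) → Unique ys → φ ≻ toList ys →
    (λ c → Σ (Vec V (suc n)) λ as → All W as × ⌞ c ≅ tuple as ⌟ × ‖ φ ‖f (v [ ys ≔* as ])) ∈W W
  safe-tuples∈W φ n ys unique safe = ∈W-resp (tuples∈W (separable-‖‖f safe ys (W-bound B)))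
    (λ c (as , al , e , p) → as , All.map (λ (lift m) → W-trans (W-bound B) m) al , e , p)
    (λ c (as , _ , e , p) →
       as , All-[≔*] v ys as unique (λ y y∈ys → lift (within B (v 0 ∷ []) v0∈S₀ _ (agree as) p y y∈ys)) , e , p)
    where
    B = safe-bounded safe (0 ∷ []) (W-set S₀)
    agree : ∀ as → AgreeOff (FvF φ) (toList ys) (v [ ys ≔* as ]) (v [ 0 ∷ [] ≔* v 0 ∷ [] ])
    agree as z _ z∉ys = ≅-trans (≡⇒≅ ([≔*]-outside v ys as z∉ys)) (v≋v₀ z)

  bounded-tuples∈W : (φ : Formula) (n : ℕ) (ys : Vec Var (suc n)) → φ ≻ [] → (X : V) → W X →
    (λ c → Σ (Vec V (suc n)) λ as → All (λ a → ⌞ a ∈ᵥ X ⌟) as × ⌞ c ≅ tuple as ⌟ × ‖ φ ‖f (v [ ys ≔* as ])) ∈W W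
  bounded-tuples∈W φ n ys safe X wX = tuples∈W (separable-‖‖f safe ys wX)

theorem2p16 : ExcludedMiddle (lsuc lzero) →
    (W : V → Set₁) → IsUniverse W →
    (v : Assignment) → ((x : Var) → W (v x)) →
    let open Semantics W in
    ((t : Term) → ‖ t ‖t v ∈W W)
    × ((φ : Formula) (n : ℕ) (ys : Vec Var (suc n)) → Unique ys →
         φ ≻ toList ys →
         (λ c → Σ (Vec V (suc n)) λ as → All W as × ⌞ c ≅ tuple as ⌟
                  × ‖ φ ‖f (v [ ys ≔* as ])) ∈W W)
    × ((φ : Formula) (n : ℕ) (ys : Vec Var (suc n)) → Unique ys →
         φ ≻ [] → ((y : Var) → y ∈ℓ toList ys → y ∈ℓ FvF φ) →
         (X : V) → W X →
         (λ c → Σ (Vec V (suc n)) λ as → All (λ a → ⌞ a ∈ᵥ X ⌟) as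
                  × ⌞ c ≅ tuple as ⌟ × ‖ φ ‖f (v [ ys ≔* as ])) ∈W W)
theorem2p16 lem W U v v∈W =
  term-values∈W lem W U v v∈W ,
  safe-tuples∈W lem W U v v∈W ,
  λ φ n ys _ safe _ → bounded-tuples∈W lem W U v v∈W φ n ys safe
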